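{- Let $\bar{\mathbf x},\bar{\mathbf y}\in\mathbb{P}(\mathbb{Z})$ be distinct and non-adjacent, and let $r,l,A_r,B_l,\bar{\mathbf e}_1,\bar{\mathbf f}_1$ be produced by the transition algorithm for $\bar{\mathbf x},\bar{\mathbf y}$ (see context). 1. For each of the two equivalence classes $C$ of $\sim_{\{\bar{\mathbf x},\bar{\mathbf y}\}}$ there is a unique shortest path from $\bar{\mathbf x}$ to $\bar{\mathbf y}$ in $G$ all of whose vertices other than $\bar{\mathbf x},\bar{\mathbf y}$ lie in $C$. Its length is $d_a(\bar{\mathbf x},\bar{\mathbf y})=1+A_r$ if $C$ is the class containing $\bar{\mathbf e}_1$, and $d_b(\bar{\mathbf x},\bar{\mathbf y})=1+B_l$ if $C$ is the class containing $\bar{\mathbf f}_1$. In particular, the distant graph $G$ is connected. 2. There are at most two shortest consistent paths connecting $\bar{\mathbf x}$ and $\bar{\mathbf y}$ in $G$. 3. There is a unique shortest consistent path connecting $\bar{\mathbf x}$ and $\bar{\mathbf y}$ if and only if $d_a(\bar{\mathbf x},\bar{\mathbf y})\neq d_b(\bar{\mathbf x},\bar{\mathbf y})$.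
   Context: **Projective line and distant graph.** The points of $\mathbb{P}(\mathbb{Z})$ are the cyclic submodules $\bar{\mathbf v}=\mathbb{Z}\mathbf v\subset\mathbb{Z}^2$, where $\mathbf v=(a,b)\in\mathbb{Z}^2$ is unimodular, i.e. $\gcd(a,b)=1$. A point determines its generator up to sign; such a generator is called a representative. Two points $\bar{\mathbf x},\bar{\mathbf y}$ are adjacent (distant), written $\bar{\mathbf x}\,\Delta\,\bar{\mathbf y}$, if $\det[\mathbf x,\mathbf y]=\pm1$; here $[\mathbf x,\mathbf y]$ is the matrix with columns $\mathbf x,\mathbf y$. The distant graph $G$ has vertex set $\mathbb{P}(\mathbb{Z})$ and edges the pairs of adjacent points. A path is a sequence of distinct vertices with consecutive ones adjacent, and its length is its number of edges. **Cone relation.** Let $\bar{\mathbf x}\ne\bar{\mathbf y}$ have representatives $\mathbf x,\mathbf y$. Every point $\bar{\mathbf u}\notin\{\bar{\mathbf x},\bar{\mathbf y}\}$ has a representative $\mathbf u=\alpha\mathbf x+\beta\mathbf y$ with real $\alpha,\beta\ne0$. Write $\mathbf v=\alpha'\mathbf x+\beta'\mathbf y$ for a representative of another such point $\bar{\mathbf v}$. Then $\bar{\mathbf u}\sim_{\{\bar{\mathbf x},\bar{\mathbf y}\}}\bar{\mathbf v}$ means that $\alpha\beta$ and $\alpha'\beta'$ have the same sign. This is an equivalence relation on $\mathbb{P}(\mathbb{Z})\setminus\{\bar{\mathbf x},\bar{\mathbf y}\}$ with exactly two classes: the points represented in the open cone $\{\alpha\beta>0\}$ and those represented in $\{\alpha\beta<0\}$.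 **Consistent paths.** A path from $\bar{\mathbf x}$ to $\bar{\mathbf y}$ is consistent if all its vertices other than $\bar{\mathbf x},\bar{\mathbf y}$ lie in one equivalence class of $\sim_{\{\bar{\mathbf x},\bar{\mathbf y}\}}$. **Transition algorithm** (for distinct non-adjacent $\bar{\mathbf x},\bar{\mathbf y}$, with fixed representatives $\mathbf x,\mathbf y$). - Put $P=\{\alpha\mathbf x+\beta\mathbf y:\alpha>0,\beta>0\}$ and $N=\{\alpha\mathbf x+\beta\mathbf y:\alpha<0,\beta>0\}$. - The integer vectors $\mathbf c$ with $|\det[\mathbf x,\mathbf c]|=1$ and $\beta>0$ form a sequence $\mathbf c_n=\mathbf c_0-n\mathbf x$, $n\in\mathbb{Z}$. There is a unique $n$ with $\mathbf u:=\mathbf c_n\in P$ and $\mathbf w:=\mathbf c_{n+1}\in N$. - If $\mathbf u+\mathbf w=\mathbf y$, put $\mathbf e_1=\mathbf u$, $\mathbf f_1=\mathbf w$, $r=l=0$, and stop. - Otherwise let $Q_e$ be the one of $P,N$ containing $\mathbf u+\mathbf w$ and $Q_f$ the other. Let $\mathbf e_1$ be the one of $\mathbf u,\mathbf w$ lying in $Q_e$, and $\mathbf f_1$ the other. - Start with the lists $(\mathbf e_1)$ and $(\mathbf f_1)$ and repeat the following. Let $\mathbf e,\mathbf f$ be the last entries of the lists and $\mathbf s=\mathbf e+\mathbf f$. If $\mathbf s=\mathbf y$, stop. If $\mathbf s\in Q_e$, append $\mathbf s$ to the e-list (an E-step). Otherwise $\mathbf s\in Q_f$, and append $\mathbf s$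 to the f-list (an F-step). - This always terminates. The word of steps has the form $E^{a_1}F^{b_1}E^{a_2}F^{b_2}\cdots$ with all exponents $\ge1$. Let $r$ be the number of E-blocks and $l$ the number of F-blocks, so $r-l\in\{0,1\}$. - Put $a_0=b_0=a_{r+1}=b_{l+1}=1$, $A_k=\sum_{n=0}^k a_n$ and $B_k=\sum_{n=0}^k b_n$. Then the e-list is $(\mathbf e_1,\dots,\mathbf e_{A_r})$ and the f-list is $(\mathbf f_1,\dots,\mathbf f_{B_l})$. - Write $\bar{\mathbf e}_i,\bar{\mathbf f}_j$ for the corresponding points. -}

module Defs where

open import Data.Nat as ℕ using (ℕ; zero; suc)
open import Data.Nat.GCD using (gcd)
open import Data.Integer using (ℤ; +_; _*_; _-_; _+_; _<_; ∣_∣; -_; 0ℤ)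
open import Data.Product using (Σ; _×_; _,_)
open import Data.Sum using (_⊎_)
open import Data.Fin using (Fin; fromℕ; inject₁; toℕ)
  renaming (zero to fzero; suc to fsuc)
open import Relation.Nullary using (¬_)
open import Relation.Binary.PropositionalEquality using (_≡_; _≢_)

V2 : Set
V2 = ℤ × ℤ

_⊕_ : V2 → V2 → V2
(a , b) ⊕ (c , d) = (a + c , b + d)

_⊖_ : V2 → V2 → V2
(a , b) ⊖ (c , d) = (a - c , b - d)

neg : V2 → V2
neg (a , b) = (- a , - b)

det : V2 → V2 → ℤ
det (a , b) (c , d) = a * d - b * c

Unimodular : V2 → Set
Unimodular (a , b) = gcd ∣ a ∣ ∣ b ∣ ≡ 1

-- The projective line P(ℤ): points are given by a representative;
-- two representatives give the same point iff they agree up to sign.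

record Pt : Set where
  constructor pt
  field
    vec     : V2
    unimod  : Unimodular vec
open Pt public

_≈_ : Pt → Pt → Set
p ≈ q = vec p ≡ vec q ⊎ vec p ≡ neg (vec q)

Adj : Pt → Pt → Set
Adj p q = det (vec p) (vec q) ≡ + 1 ⊎ det (vec p) (vec q) ≡ - (+ 1)

record Path (p q : Pt) (n : ℕ) : Set where
  field
    vtx      : Fin (suc n) → Pt
    start    : vtx fzero ≈ p
    end      : vtx (fromℕ n) ≈ q
    adjacent : (i : Fin n) → Adj (vtx (inject₁ i)) (vtx (fsuc i))
    distinct : (i j : Fin (suc n)) → vtx i ≈ vtx j → i ≡ j
open Path public

PathEq : ∀ {p q n m} → Path p q n → Path p q m → Set
PathEq {n = n} {m} P Q =
  n ≡ m × ((i : Fin (suc n)) (j : Fin (suc m)) → toℕ i ≡ toℕ j → vtx P i ≈ vtx Q j)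

-- For v = α x + β y (real α, β) Cramer's rule gives
--   α = det[v,y] / det[x,y],   β = det[x,v] / det[x,y],
-- hence sign α = sign (det[v,y]·det[x,y]), sign β = sign (det[x,v]·det[x,y]).

αnum : V2 → V2 → V2 → ℤ
αnum x y v = det v y * det x y

βnum : V2 → V2 → V2 → ℤ
βnum x y v = det x v * det x y

κ : V2 → V2 → V2 → ℤ
κ x y v = αnum x y v * βnum x y v

ConeRel : V2 → V2 → V2 → V2 → Set
ConeRel x y u v = (0ℤ < κ x y u × 0ℤ < κ x y v) ⊎ (κ x y u < 0ℤ × κ x y v < 0ℤ)

InP : V2 → V2 → V2 → Set
InP x y v = 0ℤ < αnum x y v × 0ℤ < βnum x y v

InN : V2 → V2 → V2 → Set
InN x y v = αnum x y v < 0ℤ × 0ℤ < βnum x y v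

Start : V2 → V2 → V2 → Set
Start x y u = ∣ det x u ∣ ≡ 1 × InP x y u × InN x y (u ⊖ x)

-- Execution of the main loop, with current last entries e, f of the
-- e-list and f-list; indices a, b = numbers of E-steps and F-steps
-- performed until termination.
data Loop (y : V2) (Qe : V2 → Set) : V2 → V2 → ℕ → ℕ → Set where
  stop  : ∀ {e f} → e ⊕ f ≡ y → Loop y Qe e f 0 0
  eStep : ∀ {e f a b} → e ⊕ f ≢ y → Qe (e ⊕ f) →
          Loop y Qe (e ⊕ f) f a b → Loop y Qe e f (suc a) b
  fStep : ∀ {e f a b} → e ⊕ f ≢ y → ¬ Qe (e ⊕ f) →
          Loop y Qe e (e ⊕ f) a b → Loop y Qe e f a (suc b)

-- Transition x y e₁ f₁ Aᵣ B_l : a run of the transition algorithm for the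
-- representatives x, y, with outputs e₁, f₁ and Aᵣ = length of the e-list
-- = 1 + a₁ + … + a_r, B_l = length of the f-list = 1 + b₁ + … + b_l.
data Transition (x y : V2) : V2 → V2 → ℕ → ℕ → Set where
  direct : ∀ {u} → Start x y u → u ⊕ (u ⊖ x) ≡ y →
           Transition x y u (u ⊖ x) 1 1
  viaP   : ∀ {u a b} → Start x y u → u ⊕ (u ⊖ x) ≢ y →
           InP x y (u ⊕ (u ⊖ x)) →
           Loop y (InP x y) u (u ⊖ x) a b →
           Transition x y u (u ⊖ x) (suc a) (suc b)
  viaN   : ∀ {u a b} → Start x y u → u ⊕ (u ⊖ x) ≢ y →
           InN x y (u ⊕ (u ⊖ x)) →
           Loop y (InN x y) (u ⊖ x) u a b →
           Transition x y (u ⊖ x) u (suc a) (suc b)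

Interior : ∀ {x y n} → Path x y n → Fin (suc n) → Set
Interior {x} {y} P i = ¬ (vtx P i ≈ x) × ¬ (vtx P i ≈ y)

InClassOf : ∀ {x y n} → Pt → Path x y n → Set
InClassOf {x} {y} {n} c P =
  (i : Fin (suc n)) → Interior P i → ConeRel (vec x) (vec y) (vec (vtx P i)) (vec c)

Consistent : ∀ {x y n} → Path x y n → Set
Consistent {x} {y} {n} P =
  (i j : Fin (suc n)) → Interior P i → Interior P j →
  ConeRel (vec x) (vec y) (vec (vtx P i)) (vec (vtx P j))

ShortestConsistent : ∀ {x y n} → Path x y n → Set
ShortestConsistent {x} {y} {n} P =
  Consistent P × ((m : ℕ) (Q : Path x y m) → Consistent Q → n ℕ.≤ m)

UniqueShortestConsistent : Pt → Pt → Set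
UniqueShortestConsistent x y =
  Σ ℕ λ n → Σ (Path x y n) λ P → ShortestConsistent P ×
    ((m : ℕ) (Q : Path x y m) → ShortestConsistent Q → PathEq P Q)

Connected : Set
Connected = (p q : Pt) → Σ ℕ λ n → Path p q n

-- For adjacent e, f put K e f v = det[v,f] det[e,v]; for v = α e + β f it has the sign of α β.
-- By a Plücker relation no edge of G joins a point with K < 0 to one with K > 0. Along the
-- transition algorithm the current pair (e, f) stays adjacent, x keeps K < 0, every later e-vertex
-- and y get K > 0, the e-vertices lie in one class of ~ and the f-vertices in the other. Hence a path
-- from x to y inside the class of the e-vertices must visit the current e before going on; so it
-- visits e₁, …, e_{A_r} in this order, is at least as long as x, e₁, …, e_{A_r}, y, and equals it
-- when it is not longer. The same holds for the f-vertices. A consistent path lies in one of the two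
-- classes, which gives parts 2 and 3; connectivity is the Euclidean algorithm.

module Submission where

open import Defs
open import Data.Nat using (ℕ; suc; _≤_)
open import Data.Product using (Σ; _×_)
open import Data.Sum using (_⊎_)
open import Relation.Nullary using (¬_)
open import Relation.Binary.PropositionalEquality using (_≡_; _≢_)
open import Function.Bundles using (_⇔_)

open import Data.Bool using (Bool; true; false; not)
open import Data.Bool.Properties using (not-involutive)
open import Data.Empty using (⊥; ⊥-elim)
open import Data.Fin as F using (Fin; toℕ; fromℕ; inject₁) renaming (zero to fzero; suc to fsuc)
import Data.Fin.Properties as FP
open import Data.Integer as Z using (ℤ; +_; -[1+_]; +[1+_]; 0ℤ; ∣_∣; _+_; _*_; _-_; -_; +<+; -<+)
  renaming (_<_ to _<ᶻ_; _≤_ to _≤ᶻ_)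
import Data.Integer.DivMod as ZD
import Data.Integer.Properties as ZP
open import Data.Integer.Tactic.RingSolver using (solve-∀)
open import Data.Nat as ℕ using (zero; z≤n; s≤s; _<_; _∸_)
import Data.Nat.Divisibility as ND
open import Data.Nat.GCD as G using (gcd)
import Data.Nat.Properties as NP
open import Data.Product using (_,_; proj₁; proj₂)
import Data.Product as Product
open import Data.Sum using (inj₁; inj₂; [_,_]′)
import Data.Sum as Sum
open import Function using (_∘_; id)
open import Function.Bundles using (mk⇔)
open import Relation.Binary.Definitions using (tri<; tri≈; tri>)
open import Relation.Binary.PropositionalEquality using (refl; sym; trans; cong; cong₂; subst; subst₂; module ≡-Reasoning)
open import Relation.Nullary using (Dec; yes; no)

HasSign : Bool → ℤ → Set
HasSign true  z = 0ℤ <ᶻ z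
HasSign false z = z <ᶻ 0ℤ

HasSign-exclusive : ∀ σ {z} → HasSign σ z → HasSign (not σ) z → ⊥
HasSign-exclusive true  p n = ZP.<-asym p n
HasSign-exclusive false n p = ZP.<-asym p n

HasSign⇒≢0 : ∀ σ {z} → HasSign σ z → z ≢ 0ℤ
HasSign⇒≢0 true  p refl = ZP.<-irrefl refl p
HasSign⇒≢0 false n refl = ZP.<-irrefl refl n

HasSign-trichotomy : ∀ z → z ≢ 0ℤ → HasSign true z ⊎ HasSign false z
HasSign-trichotomy z z≢0 with ZP.<-cmp 0ℤ z
... | tri< p _ _ = inj₁ p
... | tri≈ _ e _ = ⊥-elim (z≢0 (sym e))
... | tri> _ _ n = inj₂ n

HasSign-or-not : ∀ σ {z} → HasSign true z ⊎ HasSign false z → HasSign σ z ⊎ HasSign (not σ) z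
HasSign-or-not true  s = s
HasSign-or-not false (inj₁ p) = inj₂ p
HasSign-or-not false (inj₂ n) = inj₁ n

pos*pos⇒pos : ∀ {a b} → 0ℤ <ᶻ a → 0ℤ <ᶻ b → 0ℤ <ᶻ a * b
pos*pos⇒pos (+<+ (s≤s _)) (+<+ (s≤s _)) = +<+ (s≤s z≤n)

neg*neg⇒pos : ∀ {a b} → a <ᶻ 0ℤ → b <ᶻ 0ℤ → 0ℤ <ᶻ a * b
neg*neg⇒pos -<+ -<+ = +<+ (s≤s z≤n)

neg*pos⇒neg : ∀ {a b} → a <ᶻ 0ℤ → 0ℤ <ᶻ b → a * b <ᶻ 0ℤ
neg*pos⇒neg -<+ (+<+ (s≤s _)) = -<+

*-neg⇒oppositeSigns : ∀ a b → a * b <ᶻ 0ℤ → (0ℤ <ᶻ a × b <ᶻ 0ℤ) ⊎ (a <ᶻ 0ℤ × 0ℤ <ᶻ b)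
*-neg⇒oppositeSigns a b ab<0 with ZP.<-cmp 0ℤ a | ZP.<-cmp 0ℤ b
... | tri< a>0 _ _ | tri< b>0 _ _ = ⊥-elim (ZP.<-asym ab<0 (pos*pos⇒pos a>0 b>0))
... | tri< a>0 _ _ | tri> _ _ b<0 = inj₁ (a>0 , b<0)
... | tri> _ _ a<0 | tri< b>0 _ _ = inj₂ (a<0 , b>0)
... | tri> _ _ a<0 | tri> _ _ b<0 = ⊥-elim (ZP.<-asym ab<0 (neg*neg⇒pos a<0 b<0))
... | tri≈ _ refl _ | _ = ⊥-elim (ZP.<-irrefl refl ab<0)
... | _ | tri≈ _ refl _ = ⊥-elim (ZP.<-irrefl (ZP.*-zeroʳ a) ab<0)

square-nonNeg : ∀ a → 0ℤ ≤ᶻ a * a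
square-nonNeg a with ZP.<-cmp 0ℤ a
... | tri< a>0 _ _ = ZP.<⇒≤ (pos*pos⇒pos a>0 a>0)
... | tri≈ _ refl _ = ZP.≤-refl
... | tri> _ _ a<0 = ZP.<⇒≤ (neg*neg⇒pos a<0 a<0)

square-pos : ∀ a → a ≢ 0ℤ → 0ℤ <ᶻ a * a
square-pos a a≢0 = ZP.≤∧≢⇒< (square-nonNeg a) λ e → a≢0 ([ id , id ]′ (ZP.i*j≡0⇒i≡0∨j≡0 a (sym e)))

neg-minus-square : ∀ k a → k <ᶻ 0ℤ → k - a * a <ᶻ 0ℤ
neg-minus-square k a k<0 = ZP.≤-<-trans (ZP.i-j≤i k (a * a) {{Z.nonNegative (square-nonNeg a)}}) k<0

pos-plus-square : ∀ k a → 0ℤ <ᶻ k - a * a → 0ℤ <ᶻ k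
pos-plus-square k a h = ZP.<-≤-trans h (ZP.i-j≤i k (a * a) {{Z.nonNegative (square-nonNeg a)}})

IsUnit : ℤ → Set
IsUnit z = z ≡ + 1 ⊎ z ≡ - (+ 1)

IsUnit-neg : ∀ {z} → IsUnit z → IsUnit (- z)
IsUnit-neg (inj₁ refl) = inj₂ refl
IsUnit-neg (inj₂ refl) = inj₁ refl

IsUnit-neg⁻ : ∀ {z} → IsUnit (- z) → IsUnit z
IsUnit-neg⁻ {z} h = subst IsUnit (ZP.neg-involutive z) (IsUnit-neg h)

IsUnit-* : ∀ {a b} → IsUnit a → IsUnit b → IsUnit (a * b)
IsUnit-* (inj₁ refl) (inj₁ refl) = inj₁ refl
IsUnit-* (inj₁ refl) (inj₂ refl) = inj₂ refl
IsUnit-* (inj₂ refl) (inj₁ refl) = inj₂ refl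
IsUnit-* (inj₂ refl) (inj₂ refl) = inj₁ refl

IsUnit-square : ∀ {z} → IsUnit z → z * z ≡ + 1
IsUnit-square (inj₁ refl) = refl
IsUnit-square (inj₂ refl) = refl

IsUnit-*-neg : ∀ {z} → IsUnit z → z * (- z) <ᶻ 0ℤ
IsUnit-*-neg (inj₁ refl) = -<+
IsUnit-*-neg (inj₂ refl) = -<+

∣∣≡1⇒IsUnit : ∀ {z} → ∣ z ∣ ≡ 1 → IsUnit z
∣∣≡1⇒IsUnit {+ .1} refl = inj₁ refl
∣∣≡1⇒IsUnit { -[1+ zero ]} refl = inj₂ refl

*≡1⇒IsUnitʳ : ∀ m l → m * l ≡ + 1 → IsUnit l
*≡1⇒IsUnitʳ m l h = ∣∣≡1⇒IsUnit (NP.m*n≡1⇒n≡1 ∣ m ∣ ∣ l ∣ (trans (sym (ZP.abs-* m l)) (cong ∣_∣ h)))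

-- |p - r| = |p| + |r| ≥ 2 when p and r have opposite signs.
oppositeSigns⇒¬IsUnit-diff : ∀ p r → p * r <ᶻ 0ℤ → ¬ IsUnit (p - r)
oppositeSigns⇒¬IsUnit-diff p r pr<0 u with *-neg⇒oppositeSigns p r pr<0
oppositeSigns⇒¬IsUnit-diff .(+[1+ m ]) .(-[1+ n ]) _ (inj₁ e) | inj₁ (+<+ {n = suc m} _ , -<+ {m = n})
  with trans (sym (NP.+-suc (suc m) n)) (ZP.+-injective e)
... | ()
oppositeSigns⇒¬IsUnit-diff .(+[1+ m ]) .(-[1+ n ]) _ (inj₂ ()) | inj₁ (+<+ {n = suc m} _ , -<+ {m = n})
oppositeSigns⇒¬IsUnit-diff .(-[1+ m ]) .(+[1+ n ]) _ (inj₁ ()) | inj₂ (-<+ {m = m} , +<+ {n = suc n} _)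
oppositeSigns⇒¬IsUnit-diff .(-[1+ m ]) .(+[1+ n ]) _ (inj₂ e) | inj₂ (-<+ {m = m} , +<+ {n = suc n} _)
  with cong ∣_∣ e
... | ()

det-negˡ : ∀ u v → det (neg u) v ≡ - det u v
det-negˡ (a , b) (c , d) = lem a b c d
  where lem : ∀ a b c d → (- a) * d - (- b) * c ≡ - (a * d - b * c)
        lem = solve-∀

det-negʳ : ∀ u v → det u (neg v) ≡ - det u v
det-negʳ (a , b) (c , d) = lem a b c d
  where lem : ∀ a b c d → a * (- d) - b * (- c) ≡ - (a * d - b * c)
        lem = solve-∀

det-antisym : ∀ u v → det u v ≡ - det v u
det-antisym (a , b) (c , d) = lem a b c d
  where lem : ∀ a b c d → a * d - b * c ≡ - (c * b - d * a)
        lem = solve-∀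

det-self : ∀ u → det u u ≡ 0ℤ
det-self (a , b) = lem a b
  where lem : ∀ a b → a * b - b * a ≡ 0ℤ
        lem = solve-∀

det-distribˡ-⊕ : ∀ e f v → det v (e ⊕ f) ≡ det v e + det v f
det-distribˡ-⊕ (a , b) (c , d) (p , q) = lem a b c d p q
  where lem : ∀ a b c d p q → p * (b + d) - q * (a + c) ≡ (p * b - q * a) + (p * d - q * c)
        lem = solve-∀

det-shearʳ : ∀ e f → det e (e ⊕ f) ≡ det e f
det-shearʳ (a , b) (c , d) = lem a b c d
  where lem : ∀ a b c d → a * (b + d) - b * (a + c) ≡ a * d - b * c
        lem = solve-∀

det-shearˡ : ∀ e f → det (e ⊕ f) f ≡ det e f
det-shearˡ (a , b) (c , d) = lem a b c d
  where lem : ∀ a b c d → (a + c) * d - (b + d) * c ≡ a * d - b * c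
        lem = solve-∀

det-plücker : ∀ u v e f → det u v * det e f ≡ det u f * det e v - det e u * det v f
det-plücker (a , b) (c , d) (p , q) (r , s) = lem a b c d p q r s
  where lem : ∀ a b c d p q r s → (a * d - b * c) * (p * s - q * r)
               ≡ (a * s - b * r) * (p * d - q * c) - (p * b - q * a) * (c * s - d * r)
        lem = solve-∀

κ-neg : ∀ x y v → κ x y (neg v) ≡ κ x y v
κ-neg x y v rewrite det-negˡ v y | det-negʳ x v = lem (det v y) (det x y) (det x v)
  where lem : ∀ a d b → ((- a) * d) * ((- b) * d) ≡ (a * d) * (b * d)
        lem = solve-∀

κ-left : ∀ x y → κ x y x ≡ 0ℤ
κ-left x y rewrite det-self x = ZP.*-zeroʳ (αnum x y x)

κ-right : ∀ x y → κ x y y ≡ 0ℤ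
κ-right x y rewrite det-self y = refl

βnum-⊕ : ∀ x y u w → βnum x y (u ⊕ w) ≡ βnum x y u + βnum x y w
βnum-⊕ x y u w rewrite det-distribˡ-⊕ u w x = ZP.*-distribʳ-+ (det x y) (det x u) (det x w)

βnum-neg : ∀ x y v → βnum x y (neg v) ≡ - βnum x y v
βnum-neg x y v rewrite det-negʳ x v = sym (ZP.neg-distribˡ-* (det x v) (det x y))

-- For v = α e + β f one has K e f v = α β det[e,f]², so K e f is the cone function of the
-- pair e, f without the normalising factor.
K : V2 → V2 → V2 → ℤ
K e f v = det v f * det e v

K-neg : ∀ e f v → K e f (neg v) ≡ K e f v
K-neg e f v rewrite det-negˡ v f | det-negʳ e v = lem (det v f) (det e v)
  where lem : ∀ z w → (- z) * (- w) ≡ z * w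
        lem = solve-∀

K-swap : ∀ e f v → K f e v ≡ K e f v
K-swap (a , b) (c , d) (p , q) = lem a b c d p q
  where lem : ∀ a b c d p q → (p * b - q * a) * (c * q - d * p) ≡ (p * d - q * c) * (a * q - b * p)
        lem = solve-∀

K-eStep : ∀ e f v → K (e ⊕ f) f v ≡ K e f v - det v f * det v f
K-eStep (a , b) (c , d) (p , q) = lem a b c d p q
  where lem : ∀ a b c d p q → (p * d - q * c) * ((a + c) * q - (b + d) * p)
               ≡ (p * d - q * c) * (a * q - b * p) - (p * d - q * c) * (p * d - q * c)
        lem = solve-∀

K-fStep : ∀ e f v → K e (e ⊕ f) v ≡ K e f v - det e v * det e v
K-fStep (a , b) (c , d) (p , q) = lem a b c d p q
  where lem : ∀ a b c d p q → (p * (b + d) - q * (a + c)) * (a * q - b * p)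
               ≡ (p * d - q * c) * (a * q - b * p) - (a * q - b * p) * (a * q - b * p)
        lem = solve-∀

K-sum : ∀ e f → K e f (e ⊕ f) ≡ det e f * det e f
K-sum e f rewrite det-shearˡ e f | det-shearʳ e f = refl

K-self : ∀ e f → K e f e ≡ 0ℤ
K-self e f rewrite det-self e = ZP.*-zeroʳ (det e f)

-- The two terms of the Plücker relation for det[u,v] det[e,f] have opposite signs.
no-edge-across-cone : ∀ u v e f → IsUnit (det e f) → K e f u <ᶻ 0ℤ → 0ℤ <ᶻ K e f v → ¬ IsUnit (det u v)
no-edge-across-cone u v e f hef ku kv huv =
  oppositeSigns⇒¬IsUnit-diff P R PR<0 (subst IsUnit (det-plücker u v e f) (IsUnit-* huv hef))
  where
    P = det u f * det e v
    R = det e u * det v f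
    lem : ∀ a b c d → (a * c) * (b * d) ≡ (a * b) * (d * c)
    lem = solve-∀
    PR<0 : P * R <ᶻ 0ℤ
    PR<0 = subst (_<ᶻ 0ℤ) (sym (lem (det u f) (det e u) (det e v) (det v f))) (neg*pos⇒neg ku kv)

Primitive : V2 → Set
Primitive (a , b) = Σ ℤ λ s → Σ ℤ λ t → s * a + t * b ≡ + 1

IsUnit-det⇒Primitiveˡ : ∀ e f → IsUnit (det e f) → Primitive e
IsUnit-det⇒Primitiveˡ (a , b) (c , d) (inj₁ h) = d , - c , trans (lem a b c d) h
  where lem : ∀ a b c d → d * a + (- c) * b ≡ a * d - b * c
        lem = solve-∀
IsUnit-det⇒Primitiveˡ (a , b) (c , d) (inj₂ h) = - d , c , trans (lem a b c d) (cong -_ h)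
  where lem : ∀ a b c d → (- d) * a + c * b ≡ - (a * d - b * c)
        lem = solve-∀

IsUnit-det⇒Primitiveʳ : ∀ e f → IsUnit (det e f) → Primitive f
IsUnit-det⇒Primitiveʳ (a , b) (c , d) (inj₁ h) = - b , a , trans (lem a b c d) h
  where lem : ∀ a b c d → (- b) * c + a * d ≡ a * d - b * c
        lem = solve-∀
IsUnit-det⇒Primitiveʳ (a , b) (c , d) (inj₂ h) = b , - a , trans (lem a b c d) (cong -_ h)
  where lem : ∀ a b c d → b * c + (- a) * d ≡ - (a * d - b * c)
        lem = solve-∀

Bézout⇒Primitive : ∀ {m n} → G.Bézout.Identity 1 m n → Primitive (+ m , + n)
Bézout⇒Primitive {m} {n} (G.Bézout.+- x y eq) =
  + x , - (+ y) , trans (cong (_+ (- (+ y)) * + n) (sym eqℤ)) (lem (+ y) (+ n))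
  where
    eqℤ : + 1 + + y * + n ≡ + x * + m
    eqℤ = trans (cong (_+_ (+ 1)) (sym (ZP.pos-* y n))) (trans (cong +_ eq) (ZP.pos-* x m))
    lem : ∀ y n → (+ 1 + y * n) + (- y) * n ≡ + 1
    lem = solve-∀
Bézout⇒Primitive {m} {n} (G.Bézout.-+ x y eq) =
  - (+ x) , + y , trans (cong (_+_ ((- (+ x)) * + m)) (sym eqℤ)) (lem (+ x) (+ m))
  where
    eqℤ : + 1 + + x * + m ≡ + y * + n
    eqℤ = trans (cong (_+_ (+ 1)) (sym (ZP.pos-* x m))) (trans (cong +_ eq) (ZP.pos-* y n))
    lem : ∀ x m → (- x) * m + (+ 1 + x * m) ≡ + 1
    lem = solve-∀

∃-sign*≡∣∣ : ∀ a → Σ ℤ λ s → s * a ≡ + ∣ a ∣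
∃-sign*≡∣∣ (+ n) = + 1 , ZP.*-identityˡ (+ n)
∃-sign*≡∣∣ -[1+ n ] = - (+ 1) , ZP.-1*i≡-i -[1+ n ]

Primitive-∣∣ : ∀ a b → Primitive (+ ∣ a ∣ , + ∣ b ∣) → Primitive (a , b)
Primitive-∣∣ a b (s , t , e) with ∃-sign*≡∣∣ a | ∃-sign*≡∣∣ b
... | sa , ea | sb , eb =
  s * sa , t * sb , trans (lem s sa a t sb b) (trans (cong₂ (λ p q → s * p + t * q) ea eb) e)
  where lem : ∀ s sa a t sb b → (s * sa) * a + (t * sb) * b ≡ s * (sa * a) + t * (sb * b)
        lem = solve-∀

Unimodular⇒Primitive : ∀ v → Unimodular v → Primitive v
Unimodular⇒Primitive (a , b) h = Primitive-∣∣ a b (Bézout⇒Primitive (G.Bézout.identity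
  (subst (G.GCD ∣ a ∣ ∣ b ∣) h (G.gcd-GCD ∣ a ∣ ∣ b ∣))))

∣∣-divisor⇒multiple : ∀ g a → g ND.∣ ∣ a ∣ → Σ ℤ λ k → a ≡ k * + g
∣∣-divisor⇒multiple g (+ n) (ND.divides q eq) = + q , trans (cong +_ eq) (ZP.pos-* q g)
∣∣-divisor⇒multiple g -[1+ n ] (ND.divides q eq) = - (+ q) ,
  trans (cong (λ m → - (+ m)) eq) (trans (cong -_ (ZP.pos-* q g)) (ZP.neg-distribˡ-* (+ q) (+ g)))

Primitive⇒Unimodular : ∀ v → Primitive v → Unimodular v
Primitive⇒Unimodular (a , b) (s , t , h)
  with ∣∣-divisor⇒multiple g a (G.gcd[m,n]∣m ∣ a ∣ ∣ b ∣) | ∣∣-divisor⇒multiple g b (G.gcd[m,n]∣n ∣ a ∣ ∣ b ∣)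
  where g = gcd ∣ a ∣ ∣ b ∣
... | k , a≡kg | l , b≡lg =
  NP.m*n≡1⇒n≡1 ∣ s * k + t * l ∣ g (trans (sym (ZP.abs-* (s * k + t * l) (+ g))) (cong ∣_∣ e))
  where
    g = gcd ∣ a ∣ ∣ b ∣
    lem : ∀ s t k l g → s * (k * g) + t * (l * g) ≡ (s * k + t * l) * g
    lem = solve-∀
    e : (s * k + t * l) * + g ≡ + 1
    e = trans (sym (lem s t k l (+ g))) (trans (cong₂ (λ p q → s * p + t * q) (sym a≡kg) (sym b≡lg)) h)

infix 4 _≋_ _≋?_

_≋_ : V2 → V2 → Set
u ≋ v = u ≡ v ⊎ u ≡ neg v

neg-involutive : ∀ v → neg (neg v) ≡ v
neg-involutive (a , b) = cong₂ _,_ (ZP.neg-involutive a) (ZP.neg-involutive b)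

≋-refl : ∀ {u} → u ≋ u
≋-refl = inj₁ refl

≋-sym : ∀ {u v} → u ≋ v → v ≋ u
≋-sym (inj₁ e) = inj₁ (sym e)
≋-sym {u} {v} (inj₂ e) = inj₂ (trans (sym (neg-involutive v)) (cong neg (sym e)))

≋-trans : ∀ {u v w} → u ≋ v → v ≋ w → u ≋ w
≋-trans (inj₁ e) h = subst (_≋ _) (sym e) h
≋-trans (inj₂ e) (inj₁ e′) = inj₂ (trans e (cong neg e′))
≋-trans {w = w} (inj₂ e) (inj₂ e′) = inj₁ (trans e (trans (cong neg e′) (neg-involutive w)))

_≟v_ : (u v : V2) → Dec (u ≡ v)
(a , b) ≟v (c , d) with a Z.≟ c | b Z.≟ d
... | yes refl | yes refl = yes refl
... | no a≢c | _ = no (λ e → a≢c (cong proj₁ e))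
... | _ | no b≢d = no (λ e → b≢d (cong proj₂ e))

_≋?_ : (u v : V2) → Dec (u ≋ v)
u ≋? v with u ≟v v | u ≟v neg v
... | yes e | _ = yes (inj₁ e)
... | no _ | yes e = yes (inj₂ e)
... | no u≢v | no u≢-v = no λ { (inj₁ e) → u≢v e ; (inj₂ e) → u≢-v e }

infixr 7 _·_

_·_ : ℤ → V2 → V2
k · (a , b) = (k * a , k * b)

·-assoc : ∀ m k u → m · (k · u) ≡ (m * k) · u
·-assoc m k (a , b) = cong₂ _,_ (sym (ZP.*-assoc m k a)) (sym (ZP.*-assoc m k b))

IsUnit-·⇒≋ : ∀ {k} u → IsUnit k → k · u ≋ u
IsUnit-·⇒≋ (a , b) (inj₁ refl) = inj₁ (cong₂ _,_ (ZP.*-identityˡ a) (ZP.*-identityˡ b))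
IsUnit-·⇒≋ (a , b) (inj₂ refl) = inj₂ (cong₂ _,_ (ZP.-1*i≡-i a) (ZP.-1*i≡-i b))

-- With s u₁ + t u₂ = 1, the multiplier is s v₁ + t v₂ (Cramer's rule).
det≡0⇒multiple : ∀ u v → Primitive u → det u v ≡ 0ℤ → Σ ℤ λ k → v ≡ k · u
det≡0⇒multiple (u₁ , u₂) (v₁ , v₂) (s , t , e) d =
  k , cong₂ _,_ (coordinate v₁ u₁ (- t) (l₁ s t u₁ u₂ v₁ v₂)) (coordinate v₂ u₂ s (l₂ s t u₁ u₂ v₁ v₂))
  where
    k = s * v₁ + t * v₂
    l₁ : ∀ s t u₁ u₂ v₁ v₂ → v₁ * (s * u₁ + t * u₂) ≡ (s * v₁ + t * v₂) * u₁ + (- t) * (u₁ * v₂ - u₂ * v₁)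
    l₁ = solve-∀
    l₂ : ∀ s t u₁ u₂ v₁ v₂ → v₂ * (s * u₁ + t * u₂) ≡ (s * v₁ + t * v₂) * u₂ + s * (u₁ * v₂ - u₂ * v₁)
    l₂ = solve-∀
    coordinate : ∀ vᵢ uᵢ c → vᵢ * (s * u₁ + t * u₂) ≡ k * uᵢ + c * (u₁ * v₂ - u₂ * v₁) → vᵢ ≡ k * uᵢ
    coordinate vᵢ uᵢ c l = begin
      vᵢ                                   ≡⟨ sym (ZP.*-identityʳ vᵢ) ⟩
      vᵢ * + 1                             ≡⟨ cong (vᵢ *_) (sym e) ⟩
      vᵢ * (s * u₁ + t * u₂)               ≡⟨ l ⟩
      k * uᵢ + c * (u₁ * v₂ - u₂ * v₁)     ≡⟨ cong (λ z → k * uᵢ + c * z) d ⟩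
      k * uᵢ + c * 0ℤ                      ≡⟨ cong (_+_ (k * uᵢ)) (ZP.*-zeroʳ c) ⟩
      k * uᵢ + 0ℤ                          ≡⟨ ZP.+-identityʳ (k * uᵢ) ⟩
      k * uᵢ                               ∎
      where open ≡-Reasoning

Primitive-·⁻¹ : ∀ {k} u → Primitive u → k · u ≡ u → k ≡ + 1
Primitive-·⁻¹ {k} (a , b) (s , t , e) ku≡u = begin
  k                          ≡⟨ sym (ZP.*-identityʳ k) ⟩
  k * + 1                    ≡⟨ cong (k *_) (sym e) ⟩
  k * (s * a + t * b)        ≡⟨ lem k s t a b ⟩
  s * (k * a) + t * (k * b)  ≡⟨ cong₂ (λ p q → s * p + t * q) (cong proj₁ ku≡u) (cong proj₂ ku≡u) ⟩
  s * a + t * b              ≡⟨ e ⟩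
  + 1                        ∎
  where
    open ≡-Reasoning
    lem : ∀ k s t a b → k * (s * a + t * b) ≡ s * (k * a) + t * (k * b)
    lem = solve-∀

det≡0⇒≋ : ∀ u v → Primitive u → Primitive v → det u v ≡ 0ℤ → u ≋ v
det≡0⇒≋ u v pu pv d with det≡0⇒multiple u v pu d | det≡0⇒multiple v u pv (trans (det-antisym v u) (cong -_ d))
... | k , v≡ku | m , u≡mv = ≋-sym (subst (_≋ u) (sym v≡ku) (IsUnit-·⇒≋ u (*≡1⇒IsUnitʳ m k mk≡1)))
  where
    mk≡1 : m * k ≡ + 1
    mk≡1 = Primitive-·⁻¹ u pu (sym (trans u≡mv (trans (cong (m ·_) v≡ku) (·-assoc m k u))))

K-resp-≋ : ∀ e f {u v} → u ≋ v → K e f u ≡ K e f v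
K-resp-≋ e f (inj₁ refl) = refl
K-resp-≋ e f {v = v} (inj₂ refl) = K-neg e f v

κ-resp-≋ : ∀ x y {u v} → u ≋ v → κ x y u ≡ κ x y v
κ-resp-≋ x y (inj₁ refl) = refl
κ-resp-≋ x y {v = v} (inj₂ refl) = κ-neg x y v

AdjV : V2 → V2 → Set
AdjV u v = IsUnit (det u v)

AdjV-respˡ-≋ : ∀ {u u′ v} → u ≋ u′ → AdjV u v → AdjV u′ v
AdjV-respˡ-≋ (inj₁ refl) h = h
AdjV-respˡ-≋ {u′ = u′} {v} (inj₂ refl) h = IsUnit-neg⁻ (subst IsUnit (det-negˡ u′ v) h)

AdjV-respʳ-≋ : ∀ {u v v′} → v ≋ v′ → AdjV u v → AdjV u v′
AdjV-respʳ-≋ (inj₁ refl) h = h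
AdjV-respʳ-≋ {u} {v′ = v′} (inj₂ refl) h = IsUnit-neg⁻ (subst IsUnit (det-negʳ u v′) h)

AdjV-sym : ∀ {u v} → AdjV u v → AdjV v u
AdjV-sym {u} {v} h = subst IsUnit (sym (det-antisym v u)) (IsUnit-neg h)

-- Indexing by ℕ avoids the Fin bookkeeping of Path; the values g k for k > n are junk.
record NPath (p q : Pt) (n : ℕ) : Set where
  field
    g     : ℕ → Pt
    g0    : g 0 ≈ p
    gn    : g n ≈ q
    gadj  : ∀ k → suc k ≤ n → Adj (g k) (g (suc k))
    gdist : ∀ i j → i ≤ n → j ≤ n → g i ≈ g j → i ≡ j
open NPath public

toPath : ∀ {p q n} → NPath p q n → Path p q n
toPath {p} {q} {n} P = record
  { vtx = λ i → g P (toℕ i)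
  ; start = g0 P
  ; end = subst (λ k → g P k ≈ q) (sym (FP.toℕ-fromℕ n)) (gn P)
  ; adjacent = λ i → subst (λ k → Adj (g P k) (g P (suc (toℕ i)))) (sym (FP.toℕ-inject₁ i))
                       (gadj P (toℕ i) (FP.toℕ<n i))
  ; distinct = λ i j h → FP.toℕ-injective (gdist P (toℕ i) (toℕ j) (FP.toℕ≤pred[n] i) (FP.toℕ≤pred[n] j) h)
  }

clamp : (m : ℕ) → ℕ → Fin (suc m)
clamp zero _ = fzero
clamp (suc m) zero = fzero
clamp (suc m) (suc k) = fsuc (clamp m k)

toℕ-clamp : ∀ m k → k ≤ m → toℕ (clamp m k) ≡ k
toℕ-clamp zero .zero z≤n = refl
toℕ-clamp (suc m) zero _ = refl
toℕ-clamp (suc m) (suc k) (s≤s h) = cong suc (toℕ-clamp m k h)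

clamp-toℕ : ∀ m (i : Fin (suc m)) → clamp m (toℕ i) ≡ i
clamp-toℕ m i = FP.toℕ-injective (toℕ-clamp m (toℕ i) (FP.toℕ≤pred[n] i))

fromPath : ∀ {p q n} → Path p q n → NPath p q n
fromPath {p} {q} {n} P = record
  { g = λ k → vtx P (clamp n k)
  ; g0 = subst (λ i → vtx P i ≈ p) (sym (clamp-toℕ n fzero)) (start P)
  ; gn = subst (λ i → vtx P i ≈ q) (sym clamp-n) (end P)
  ; gadj = λ k h → subst₂ (λ i j → Adj (vtx P i) (vtx P j)) (clamp-inject₁ k h) (clamp-fsuc k h)
                     (adjacent P (F.fromℕ< h))
  ; gdist = λ i j hi hj h → trans (sym (toℕ-clamp n i hi)) (trans (cong toℕ (distinct P _ _ h)) (toℕ-clamp n j hj))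
  }
  where
    clamp-n : clamp n n ≡ fromℕ n
    clamp-n = FP.toℕ-injective (trans (toℕ-clamp n n NP.≤-refl) (sym (FP.toℕ-fromℕ n)))
    clamp-inject₁ : ∀ k (h : suc k ≤ n) → inject₁ (F.fromℕ< h) ≡ clamp n k
    clamp-inject₁ k h = FP.toℕ-injective (trans (FP.toℕ-inject₁ (F.fromℕ< h))
      (trans (FP.toℕ-fromℕ< h) (sym (toℕ-clamp n k (NP.≤-trans (NP.n≤1+n k) h)))))
    clamp-fsuc : ∀ k (h : suc k ≤ n) → fsuc (F.fromℕ< h) ≡ clamp n (suc k)
    clamp-fsuc k h = FP.toℕ-injective (trans (cong suc (FP.toℕ-fromℕ< h)) (sym (toℕ-clamp n (suc k) h)))

fromPath-vtx : ∀ {p q n} (P : Path p q n) (i : Fin (suc n)) → g (fromPath P) (toℕ i) ≡ vtx P i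
fromPath-vtx {n = n} P i = cong (vtx P) (clamp-toℕ n i)

PathEq-trans-sym : ∀ {p q n m k} {P : Path p q n} {Q : Path p q m} {R : Path p q k} →
                   PathEq P Q → PathEq P R → PathEq Q R
PathEq-trans-sym {n = n} {P = P} {Q} {R} (n≡m , P≈Q) (n≡k , P≈R) = trans (sym n≡m) n≡k , λ i j i≡j →
  let i<  = subst (toℕ i <_) (cong suc (sym n≡m)) (FP.toℕ<n i)
      i′  = F.fromℕ< i<
  in ≋-trans (≋-sym (P≈Q i′ i (FP.toℕ-fromℕ< i<))) (P≈R i′ j (trans (FP.toℕ-fromℕ< i<) i≡j))

⊕-comm : ∀ e f → e ⊕ f ≡ f ⊕ e
⊕-comm (a , b) (c , d) = cong₂ _,_ (ZP.+-comm a c) (ZP.+-comm b d)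

module Runs (x y : Pt) where

  xv yv : V2
  xv = vec x
  yv = vec y

  -- The main loop of the transition algorithm, with membership in Q_e expressed by the sign σ of κ.
  data Run (σ : Bool) : V2 → V2 → ℕ → ℕ → Set where
    done  : ∀ {e f} → e ⊕ f ≡ yv → Run σ e f 0 0
    estep : ∀ {e f a b} → HasSign σ (κ xv yv (e ⊕ f)) → Run σ (e ⊕ f) f a b → Run σ e f (suc a) b
    fstep : ∀ {e f a b} → HasSign (not σ) (κ xv yv (e ⊕ f)) → Run σ e (e ⊕ f) a b → Run σ e f a (suc b)

  Run-swap : ∀ {σ e f a b} → Run σ e f a b → Run (not σ) f e b a
  Run-swap {σ} {e} {f} (done s≡y) = done (trans (⊕-comm f e) s≡y)
  Run-swap {σ} {e} {f} (estep s L) =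
    fstep (subst (λ v → HasSign (not (not σ)) (κ xv yv v)) (⊕-comm e f)
                 (subst (λ τ → HasSign τ (κ xv yv (e ⊕ f))) (sym (not-involutive σ)) s))
          (subst (λ v → Run (not σ) f v _ _) (⊕-comm e f) (Run-swap L))
  Run-swap {σ} {e} {f} (fstep s L) =
    estep (subst (λ v → HasSign (not σ) (κ xv yv v)) (⊕-comm e f) s)
          (subst (λ v → Run (not σ) v e _ _) (⊕-comm e f) (Run-swap L))

  record Invariant (σ : Bool) (e f : V2) : Set where
    constructor invariant
    field
      adjacent-ef : AdjV e f
      x-outside   : K e f xv <ᶻ 0ℤ
      e-sign      : HasSign σ (κ xv yv e)
      f-sign      : HasSign (not σ) (κ xv yv f)
  open Invariant public

  -- Abstract: nothing below computes with these proofs, and unfolding them makes type checking intractable.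
  abstract
    Invariant-eStep : ∀ {σ e f} → Invariant σ e f → HasSign σ (κ xv yv (e ⊕ f)) → Invariant σ (e ⊕ f) f
    Invariant-eStep {σ} {e} {f} (invariant ef x< _ f-s) s = invariant
      (subst IsUnit (sym (det-shearˡ e f)) ef)
      (subst (_<ᶻ 0ℤ) (sym (K-eStep e f xv)) (neg-minus-square (K e f xv) (det xv f) x<)) s f-s

    Invariant-fStep : ∀ {σ e f} → Invariant σ e f → HasSign (not σ) (κ xv yv (e ⊕ f)) → Invariant σ e (e ⊕ f)
    Invariant-fStep {σ} {e} {f} (invariant ef x< e-s _) s = invariant
      (subst IsUnit (sym (det-shearʳ e f)) ef)
      (subst (_<ᶻ 0ℤ) (sym (K-fStep e f xv)) (neg-minus-square (K e f xv) (det e xv) x<)) e-s s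

  Invariant-swap : ∀ {σ e f} → Invariant σ e f → Invariant (not σ) f e
  Invariant-swap {σ} {e} {f} (invariant ef x< e-s f-s) = invariant
    (subst IsUnit (sym (det-antisym f e)) (IsUnit-neg ef)) (subst (_<ᶻ 0ℤ) (sym (K-swap e f xv)) x<) f-s
    (subst (λ τ → HasSign τ (κ xv yv e)) (sym (not-involutive σ)) e-s)

  ePoint : ∀ {σ e f} → Invariant σ e f → Pt
  ePoint {e = e} {f} I = pt e (Primitive⇒Unimodular e (IsUnit-det⇒Primitiveˡ e f (adjacent-ef I)))

  -- The e-list of the run followed by y.
  eVertex : ∀ {σ e f a b} → Run σ e f a b → Invariant σ e f → ℕ → Pt
  eVertex (done _) I zero = ePoint I
  eVertex (done _) I (suc k) = y
  eVertex (estep _ _) I zero = ePoint I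
  eVertex (estep s L) I (suc k) = eVertex L (Invariant-eStep I s) k
  eVertex (fstep s L) I k = eVertex L (Invariant-fStep I s) k

  eVertex-zero : ∀ {σ e f a b} (L : Run σ e f a b) I → vec (eVertex L I 0) ≡ e
  eVertex-zero (done _) I = refl
  eVertex-zero (estep _ _) I = refl
  eVertex-zero (fstep s L) I = eVertex-zero L (Invariant-fStep I s)

  eVertex-last : ∀ {σ e f a b} (L : Run σ e f a b) I → eVertex L I (suc a) ≡ y
  eVertex-last (done _) I = refl
  eVertex-last (estep s L) I = eVertex-last L (Invariant-eStep I s)
  eVertex-last (fstep s L) I = eVertex-last L (Invariant-fStep I s)

  eVertex-adj : ∀ {σ e f a b} (L : Run σ e f a b) I → ∀ k → k ≤ a → Adj (eVertex L I k) (eVertex L I (suc k))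
  eVertex-adj {e = e} {f} (done s≡y) I zero _ =
    subst (AdjV e) s≡y (subst IsUnit (sym (det-shearʳ e f)) (adjacent-ef I))
  eVertex-adj {e = e} {f} (estep s L) I zero _ =
    subst (AdjV e) (sym (eVertex-zero L (Invariant-eStep I s))) (subst IsUnit (sym (det-shearʳ e f)) (adjacent-ef I))
  eVertex-adj (estep s L) I (suc k) (s≤s k≤a) = eVertex-adj L (Invariant-eStep I s) k k≤a
  eVertex-adj (fstep s L) I k k≤a = eVertex-adj L (Invariant-fStep I s) k k≤a

  eVertex-sign : ∀ {σ e f a b} (L : Run σ e f a b) I → ∀ k → k ≤ a → HasSign σ (κ xv yv (vec (eVertex L I k)))
  eVertex-sign (done _) I zero _ = e-sign I
  eVertex-sign (estep _ _) I zero _ = e-sign I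
  eVertex-sign (estep s L) I (suc k) (s≤s k≤a) = eVertex-sign L (Invariant-eStep I s) k k≤a
  eVertex-sign (fstep s L) I k k≤a = eVertex-sign L (Invariant-fStep I s) k k≤a

  K-sum-pos : ∀ {σ e f} → Invariant σ e f → 0ℤ <ᶻ K e f (e ⊕ f)
  K-sum-pos {e = e} {f} I rewrite K-sum e f | IsUnit-square (adjacent-ef I) = +<+ (s≤s z≤n)

  -- One step decreases K by a square, so positivity of K for the later pair gives it for the earlier one.
  eVertex-inside : ∀ {σ e f a b} (L : Run σ e f a b) I → ∀ j → 1 ≤ j → j ≤ suc a → 0ℤ <ᶻ K e f (vec (eVertex L I j))
  eVertex-inside {e = e} {f} (done s≡y) I (suc zero) _ _ = subst (λ v → 0ℤ <ᶻ K e f v) s≡y (K-sum-pos I)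
  eVertex-inside (done _) I (suc (suc j)) _ (s≤s ())
  eVertex-inside {e = e} {f} (estep s L) I (suc zero) _ _ =
    subst (λ v → 0ℤ <ᶻ K e f v) (sym (eVertex-zero L (Invariant-eStep I s))) (K-sum-pos I)
  eVertex-inside {e = e} {f} (estep s L) I (suc (suc j)) _ (s≤s j≤a) =
    pos-plus-square (K e f v) (det v f)
      (subst (0ℤ <ᶻ_) (K-eStep e f v) (eVertex-inside L (Invariant-eStep I s) (suc j) (s≤s z≤n) j≤a))
    where v = vec (eVertex L (Invariant-eStep I s) (suc j))
  eVertex-inside {e = e} {f} (fstep s L) I j 1≤j j≤a =
    pos-plus-square (K e f v) (det e v)
      (subst (0ℤ <ᶻ_) (K-fStep e f v) (eVertex-inside L (Invariant-fStep I s) j 1≤j j≤a))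
    where v = vec (eVertex L (Invariant-fStep I s) j)

  StateAt : Bool → (ℕ → Pt) → ℕ → ℕ → Set
  StateAt σ w a k = Σ V2 λ e′ → Σ V2 λ f′ → vec (w k) ≡ e′ × Invariant σ e′ f′ ×
                      (∀ j → suc k ≤ j → j ≤ suc a → 0ℤ <ᶻ K e′ f′ (vec (w j)))

  stateAt : ∀ {σ e f a b} (L : Run σ e f a b) I → ∀ k → k ≤ a → StateAt σ (eVertex L I) a k
  stateAt {e = e} {f} L@(done _) I zero _ = e , f , refl , I , eVertex-inside L I
  stateAt {e = e} {f} L@(estep _ _) I zero _ = e , f , refl , I , eVertex-inside L I
  stateAt (estep s L) I (suc k) (s≤s k≤a) with stateAt L (Invariant-eStep I s) k k≤a
  ... | e′ , f′ , eq , I′ , inside = e′ , f′ , eq , I′ , λ { (suc j) (s≤s h₁) (s≤s h₂) → inside j h₁ h₂ }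
  stateAt (fstep s L) I k k≤a = stateAt L (Invariant-fStep I s) k k≤a

  module EPath {σ e f a b} (L : Run σ e f a b) (I : Invariant σ e f) (x-adj-e : AdjV xv e) where

    w : ℕ → Pt
    w = eVertex L I

    vertex : ℕ → Pt
    vertex zero = x
    vertex (suc k) = w k

    on-boundary : ∀ k → k ≤ a → Σ V2 λ e′ → Σ V2 λ f′ → Invariant σ e′ f′ × K e′ f′ (vec (w k)) ≡ 0ℤ ×
                    (∀ j → suc k ≤ j → j ≤ suc a → 0ℤ <ᶻ K e′ f′ (vec (w j)))
    on-boundary k k≤a with stateAt L I k k≤a
    ... | e′ , f′ , eq , I′ , inside = e′ , f′ , I′ , trans (cong (K e′ f′) eq) (K-self e′ f′) , inside

    w-last : w (suc a) ≡ y
    w-last = eVertex-last L I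

    -- K of the current pair separates x (< 0), the current e-vertex (= 0) and all later ones (> 0).
    vertex-distinct< : ∀ i j → i < j → j ≤ suc (suc a) → ¬ (vertex i ≈ vertex j)
    vertex-distinct< zero (suc zero) _ _ h with on-boundary 0 z≤n
    ... | e′ , f′ , I′ , K≡0 , _ = ZP.<-irrefl refl (subst (_<ᶻ 0ℤ) (trans (K-resp-≋ e′ f′ h) K≡0) (x-outside I′))
    vertex-distinct< zero (suc (suc j)) _ (s≤s j≤) h with on-boundary 0 z≤n
    ... | e′ , f′ , I′ , _ , inside =
      ZP.<-asym (inside (suc j) (s≤s z≤n) j≤) (subst (_<ᶻ 0ℤ) (K-resp-≋ e′ f′ h) (x-outside I′))
    vertex-distinct< (suc i) (suc j) (s≤s i<j) (s≤s j≤) h with on-boundary i (NP.≤-pred (NP.≤-trans i<j j≤))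
    ... | e′ , f′ , I′ , K≡0 , inside =
      ZP.<-irrefl refl (subst (0ℤ <ᶻ_) (trans (sym (K-resp-≋ e′ f′ h)) K≡0) (inside j i<j j≤))

    vertex-distinct : ∀ i j → i ≤ suc (suc a) → j ≤ suc (suc a) → vertex i ≈ vertex j → i ≡ j
    vertex-distinct i j i≤ j≤ h with NP.<-cmp i j
    ... | tri< i<j _ _ = ⊥-elim (vertex-distinct< i j i<j j≤ h)
    ... | tri≈ _ i≡j _ = i≡j
    ... | tri> _ _ j<i = ⊥-elim (vertex-distinct< j i j<i i≤ (≋-sym h))

    vertex-adj : ∀ k → suc k ≤ suc (suc a) → Adj (vertex k) (vertex (suc k))
    vertex-adj zero _ = subst (AdjV xv) (sym (eVertex-zero L I)) x-adj-e
    vertex-adj (suc k) (s≤s k<) = eVertex-adj L I k (NP.≤-pred k<)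

    ePath : NPath x y (suc (suc a))
    ePath = record
      { g = vertex ; g0 = ≋-refl ; gn = subst (_≈ y) (sym w-last) ≋-refl
      ; gadj = vertex-adj ; gdist = vertex-distinct }

    vertex-sign : ∀ k → k ≤ suc (suc a) → ¬ (vertex k ≈ x) → ¬ (vertex k ≈ y) → HasSign σ (κ xv yv (vec (vertex k)))
    vertex-sign zero _ ¬≈x _ = ⊥-elim (¬≈x ≋-refl)
    vertex-sign (suc k) (s≤s k≤) _ ¬≈y with k ℕ.≤? a
    ... | yes k≤a = eVertex-sign L I k k≤a
    ... | no k≰a = ⊥-elim (¬≈y (subst (λ t → w t ≈ y) (NP.≤-antisym (NP.≰⇒> k≰a) k≤)
                                  (subst (_≈ y) (sym w-last) ≋-refl)))

    module Minimal {m} (Q : NPath x y m)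
      (Q-sign : ∀ k → k ≤ m → ¬ (g Q k ≈ x) → ¬ (g Q k ≈ y) → HasSign σ (κ xv yv (vec (g Q k)))) where

      q : ℕ → Pt
      q = g Q

      q-primitive : ∀ k → Primitive (vec (q k))
      q-primitive k = Unimodular⇒Primitive (vec (q k)) (unimod (q k))

      avoids-f : ∀ {e′ f′} → Invariant σ e′ f′ → ∀ k → k ≤ m → ¬ (vec (q k) ≋ f′)
      avoids-f {e′} {f′} I′ k k≤m h = avoid (vec (q k) ≋? xv) (vec (q k) ≋? yv)
        where
          q-sign : HasSign (not σ) (κ xv yv (vec (q k)))
          q-sign = subst (HasSign (not σ)) (sym (κ-resp-≋ xv yv h)) (f-sign I′)
          avoid : Dec (vec (q k) ≋ xv) → Dec (vec (q k) ≋ yv) → ⊥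
          avoid (yes ≈x) _        = HasSign⇒≢0 (not σ) q-sign (trans (κ-resp-≋ xv yv ≈x) (κ-left xv yv))
          avoid (no _)   (yes ≈y) = HasSign⇒≢0 (not σ) q-sign (trans (κ-resp-≋ xv yv ≈y) (κ-right xv yv))
          avoid (no ≉x)  (no ≉y)  = HasSign-exclusive σ (Q-sign k k≤m ≉x ≉y) q-sign

      -- Q starts outside the cone of (e′, f′) and cannot jump inside (no-edge-across-cone), so before
      -- reaching the inside it visits the boundary K = 0, i.e. ±e′ or ±f′; and it avoids f′.
      visits-e-before : ∀ {e′ f′} → Invariant σ e′ f′ → ∀ j → j ≤ m → 0ℤ <ᶻ K e′ f′ (vec (q j)) →
                        Σ ℕ λ i → i ≤ j × vec (q i) ≋ e′
      visits-e-before {e′} {f′} I′ zero _ K>0 =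
        ⊥-elim (ZP.<-asym K>0 (subst (_<ᶻ 0ℤ) (sym (K-resp-≋ e′ f′ (g0 Q))) (x-outside I′)))
      visits-e-before {e′} {f′} I′ (suc j) j< K>0 with vec (q j) ≋? e′
      ... | yes h = j , NP.n≤1+n j , h
      ... | no ≉e′ with ZP.<-cmp 0ℤ (K e′ f′ (vec (q j)))
      ...   | tri< K>0′ _ _ with visits-e-before I′ j (NP.≤-trans (NP.n≤1+n j) j<) K>0′
      ...     | i , i≤j , h = i , NP.≤-trans i≤j (NP.n≤1+n j) , h
      visits-e-before {e′} {f′} I′ (suc j) j< K>0 | no ≉e′ | tri≈ _ 0≡K _
        with ZP.i*j≡0⇒i≡0∨j≡0 (det (vec (q j)) f′) (sym 0≡K)
      ... | inj₁ d = ⊥-elim (avoids-f I′ j (NP.≤-trans (NP.n≤1+n j) j<)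
                       (det≡0⇒≋ (vec (q j)) f′ (q-primitive j) (IsUnit-det⇒Primitiveʳ e′ f′ (adjacent-ef I′)) d))
      ... | inj₂ d =
        ⊥-elim (≉e′ (≋-sym (det≡0⇒≋ e′ (vec (q j)) (IsUnit-det⇒Primitiveˡ e′ f′ (adjacent-ef I′)) (q-primitive j) d)))
      visits-e-before {e′} {f′} I′ (suc j) j< K>0 | no ≉e′ | tri> _ _ K<0 =
        ⊥-elim (no-edge-across-cone (vec (q j)) (vec (q (suc j))) e′ f′ (adjacent-ef I′) K<0 K>0 (gadj Q j j<))

      visits : ∀ k → k ≤ a → Σ ℕ λ i → i ≤ m × vec (q i) ≋ vec (w k)
      visits k k≤a with stateAt L I k k≤a
      ... | e′ , f′ , eq , I′ , inside with visits-e-before I′ m NP.≤-refl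
              (subst (0ℤ <ᶻ_) (sym (K-resp-≋ e′ f′ (gn Q)))
                (subst (λ p → 0ℤ <ᶻ K e′ f′ (vec p)) w-last (inside (suc a) (s≤s k≤a) NP.≤-refl)))
      ...   | i , i≤m , h = i , i≤m , subst (vec (q i) ≋_) (sym eq) h

      visits-in-order : ∀ k k′ i j → k ≤ a → k < k′ → k′ ≤ suc a → i ≤ m → j ≤ m →
                        vec (q i) ≋ vec (w k) → vec (q j) ≋ vec (w k′) → i < j
      visits-in-order k k′ i j k≤a k<k′ k′≤ i≤m j≤m hi hj with stateAt L I k k≤a
      ... | e′ , f′ , eq , I′ , inside
        with visits-e-before I′ j j≤m (subst (0ℤ <ᶻ_) (sym (K-resp-≋ e′ f′ hj)) (inside k′ k<k′ k′≤))
      ...   | i′ , i′≤j , hi′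
        with gdist Q i i′ i≤m (NP.≤-trans i′≤j j≤m) (≋-trans hi (subst (_≋ vec (q i′)) (sym eq) (≋-sym hi′)))
      ...     | refl with NP.m≤n⇒m<n∨m≡n i′≤j
      ...       | inj₁ i<j = i<j
      ...       | inj₂ refl = ⊥-elim (vertex-distinct< (suc k) (suc k′) (s≤s k<k′) (s≤s k′≤) (≋-trans (≋-sym hi) hj))

      visit-lower : ∀ k → k ≤ a → ∀ i → i ≤ m → vec (q i) ≋ vec (w k) → suc k ≤ i
      visit-lower zero _ zero _ h = ⊥-elim (vertex-distinct< 0 1 (s≤s z≤n) (s≤s z≤n) (≋-trans (≋-sym (g0 Q)) h))
      visit-lower zero _ (suc i) _ _ = s≤s z≤n
      visit-lower (suc k) k< i i≤m h with visits k (NP.≤-trans (NP.n≤1+n k) k<)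
      ... | i′ , i′≤m , h′ = NP.<-≤-trans (s≤s (visit-lower k (NP.≤-trans (NP.n≤1+n k) k<) i′ i′≤m h′))
          (visits-in-order k (suc k) i′ i (NP.≤-trans (NP.n≤1+n k) k<) NP.≤-refl (NP.≤-trans k< (NP.n≤1+n a)) i′≤m i≤m h′ h)

      q-last : vec (q m) ≋ vec (w (suc a))
      q-last = subst (λ p → vec (q m) ≋ vec p) (sym w-last) (gn Q)

      ePath-shortest : suc (suc a) ≤ m
      ePath-shortest with visits a NP.≤-refl
      ... | i , i≤m , h = NP.<-≤-trans (s≤s (visit-lower a NP.≤-refl i i≤m h))
          (visits-in-order a (suc a) i m NP.≤-refl NP.≤-refl NP.≤-refl i≤m NP.≤-refl h q-last)

      module _ (m≡ : m ≡ suc (suc a)) where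

        visit-upper : ∀ d k → k ℕ.+ d ≡ a → ∀ i → i ≤ m → vec (q i) ≋ vec (w k) → i ≤ suc k
        visit-upper zero k k≡a i i≤m h rewrite NP.+-identityʳ k | k≡a =
          NP.≤-pred (subst (i <_) m≡ (visits-in-order a (suc a) i m NP.≤-refl NP.≤-refl NP.≤-refl i≤m NP.≤-refl h q-last))
        visit-upper (suc d) k k+d≡a i i≤m h with visits (suc k) k<a
          where k<a : suc k ≤ a
                k<a = subst (suc k ≤_) (trans (sym (NP.+-suc k d)) k+d≡a) (s≤s (NP.m≤m+n k d))
        ... | i′ , i′≤m , h′ = NP.≤-pred (NP.<-≤-trans
              (visits-in-order k (suc k) i i′ k≤a NP.≤-refl (s≤s k≤a) i≤m i′≤m h h′)
              (visit-upper d (suc k) (trans (sym (NP.+-suc k d)) k+d≡a) i′ i′≤m h′))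
          where k≤a : k ≤ a
                k≤a = subst (k ≤_) k+d≡a (NP.m≤m+n k (suc d))

        ePath-unique : ∀ t → t ≤ m → vertex t ≈ q t
        ePath-unique zero _ = ≋-sym (g0 Q)
        ePath-unique (suc k) k< with k ℕ.≤? a
        ... | no k≰a = subst (λ s → vertex (suc s) ≈ q (suc s)) a+1≡k
                (subst (_≈ q (suc (suc a))) (sym w-last) (subst (λ s → y ≈ q s) m≡ (≋-sym (gn Q))))
          where a+1≡k : suc a ≡ k
                a+1≡k = NP.≤-antisym (NP.≰⇒> k≰a) (NP.≤-pred (subst (suc k ≤_) m≡ k<))
        ... | yes k≤a with visits k k≤a
        ...   | i , i≤m , h with NP.≤-antisym (visit-lower k k≤a i i≤m h) (visit-upper (a ∸ k) k (NP.m+[n∸m]≡n k≤a) i i≤m h)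
        ...     | refl = ≋-sym h

det-x-u⊖x : ∀ x u → det x (u ⊖ x) ≡ det x u
det-x-u⊖x (a , b) (c , d) = lem a b c d
  where lem : ∀ a b c d → a * (d - b) - b * (c - a) ≡ a * d - b * c
        lem = solve-∀

det-u-u⊖x : ∀ x u → det u (u ⊖ x) ≡ det x u
det-u-u⊖x (a , b) (c , d) = lem a b c d
  where lem : ∀ a b c d → c * (d - b) - d * (c - a) ≡ a * d - b * c
        lem = solve-∀

det-u⊖x-u : ∀ x u → det (u ⊖ x) u ≡ - det x u
det-u⊖x-u (a , b) (c , d) = lem a b c d
  where lem : ∀ a b c d → (c - a) * d - (d - b) * c ≡ - (a * d - b * c)
        lem = solve-∀

det-u⊖x-x : ∀ x u → det (u ⊖ x) x ≡ - det x u
det-u⊖x-x (a , b) (c , d) = lem a b c d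
  where lem : ∀ a b c d → (c - a) * b - (d - b) * a ≡ - (a * d - b * c)
        lem = solve-∀

Qe : Bool → V2 → V2 → V2 → Set
Qe true  = InP
Qe false = InN

module Launching (x y : Pt) where
  open Runs x y public

  βnum-pos⇒det≢0 : ∀ v → 0ℤ <ᶻ βnum xv yv v → det xv yv ≢ 0ℤ
  βnum-pos⇒det≢0 v β>0 d = ZP.<-irrefl (sym (trans (cong (det xv v *_) d) (ZP.*-zeroʳ (det xv v)))) β>0

  -- α(s) = 0 would make s = ±y, and β(-y) < 0.
  αnum≢0 : ∀ s → s ≢ yv → 0ℤ <ᶻ βnum xv yv s → Primitive s → αnum xv yv s ≢ 0ℤ
  αnum≢0 s s≢y β>0 ps α≡0 = [ s≉y ∘ ≡0⇒≋y , βnum-pos⇒det≢0 s β>0 ]′ (ZP.i*j≡0⇒i≡0∨j≡0 (det s yv) α≡0)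
    where
      ≡0⇒≋y : det s yv ≡ 0ℤ → s ≋ yv
      ≡0⇒≋y = det≡0⇒≋ s yv ps (Unimodular⇒Primitive yv (unimod y))
      s≉y : ¬ (s ≋ yv)
      s≉y (inj₁ s≡y) = s≢y s≡y
      s≉y (inj₂ s≡-y) = ZP.<-asym β>0 (subst (_<ᶻ 0ℤ) (sym (trans (cong (βnum xv yv) s≡-y) (βnum-neg xv yv yv)))
        (ZP.neg-mono-< {0ℤ} {det xv yv * det xv yv} (square-pos (det xv yv) (βnum-pos⇒det≢0 s β>0))))

  Qe⇒sign : ∀ σ s → s ≢ yv → 0ℤ <ᶻ βnum xv yv s → Primitive s →
            (Qe σ xv yv s → HasSign σ (κ xv yv s)) × (¬ Qe σ xv yv s → HasSign (not σ) (κ xv yv s))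
  Qe⇒sign σ s s≢y β>0 ps = inside σ , outside σ
    where
      inside : ∀ σ → Qe σ xv yv s → HasSign σ (κ xv yv s)
      inside true  (α>0 , β>0′) = pos*pos⇒pos α>0 β>0′
      inside false (α<0 , β>0′) = neg*pos⇒neg α<0 β>0′
      outside : ∀ σ → ¬ Qe σ xv yv s → HasSign (not σ) (κ xv yv s)
      outside σ ¬Qe with ZP.<-cmp 0ℤ (αnum xv yv s) | σ
      ... | tri< α>0 _ _ | true  = ⊥-elim (¬Qe (α>0 , β>0))
      ... | tri< α>0 _ _ | false = pos*pos⇒pos α>0 β>0
      ... | tri> _ _ α<0 | true  = neg*pos⇒neg α<0 β>0
      ... | tri> _ _ α<0 | false = ⊥-elim (¬Qe (α<0 , β>0))
      ... | tri≈ _ 0≡α _ | _ = ⊥-elim (αnum≢0 s s≢y β>0 ps (sym 0≡α))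

  -- Every vector built by the loop is a sum of vectors with β > 0.
  Loop⇒Run : ∀ σ {e f a b} → Loop yv (Qe σ xv yv) e f a b → AdjV e f →
             0ℤ <ᶻ βnum xv yv e → 0ℤ <ᶻ βnum xv yv f → Run σ e f a b
  Loop⇒Run σ (stop s≡y) _ _ _ = done s≡y
  Loop⇒Run σ {e} {f} (eStep s≢y q L) ef βe βf =
    estep (proj₁ (Qe⇒sign σ (e ⊕ f) s≢y βs (IsUnit-det⇒Primitiveˡ (e ⊕ f) f sf)) q) (Loop⇒Run σ L sf βs βf)
    where sf = subst IsUnit (sym (det-shearˡ e f)) ef
          βs = subst (0ℤ <ᶻ_) (sym (βnum-⊕ xv yv e f)) (ZP.+-mono-< βe βf)
  Loop⇒Run σ {e} {f} (fStep s≢y q L) ef βe βf =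
    fstep (proj₂ (Qe⇒sign σ (e ⊕ f) s≢y βs (IsUnit-det⇒Primitiveˡ (e ⊕ f) f (subst IsUnit (sym (det-shearˡ e f)) ef))) q)
          (Loop⇒Run σ L (subst IsUnit (sym (det-shearʳ e f)) ef) βe βs)
    where βs = subst (0ℤ <ᶻ_) (sym (βnum-⊕ xv yv e f)) (ZP.+-mono-< βe βf)

  record Launch (e₁ f₁ : V2) (A B : ℕ) : Set where
    field
      σ       : Bool
      a b     : ℕ
      A≡      : A ≡ suc a
      B≡      : B ≡ suc b
      run     : Run σ e₁ f₁ a b
      inv     : Invariant σ e₁ f₁
      x-adj-e : AdjV xv e₁
      x-adj-f : AdjV xv f₁
      det≢0   : det xv yv ≢ 0ℤ

  Invariant-P : ∀ {u} → Start xv yv u → Invariant true u (u ⊖ xv)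
  Invariant-P {u} (d , (α>0 , β>0) , (α<0 , β>0′)) = invariant
    (subst IsUnit (sym (det-u-u⊖x xv u)) (∣∣≡1⇒IsUnit d))
    (subst (_<ᶻ 0ℤ) (sym (cong₂ _*_ (det-x-u⊖x xv u) (det-antisym u xv))) (IsUnit-*-neg {det xv u} (∣∣≡1⇒IsUnit d)))
    (pos*pos⇒pos α>0 β>0) (neg*pos⇒neg α<0 β>0′)

  Invariant-N : ∀ {u} → Start xv yv u → Invariant false (u ⊖ xv) u
  Invariant-N {u} (d , (α>0 , β>0) , (α<0 , β>0′)) = invariant
    (subst IsUnit (sym (det-u⊖x-u xv u)) (IsUnit-neg (∣∣≡1⇒IsUnit d)))
    (subst (_<ᶻ 0ℤ) (sym (cong (det xv u *_) (det-u⊖x-x xv u))) (IsUnit-*-neg {det xv u} (∣∣≡1⇒IsUnit d)))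
    (neg*pos⇒neg α<0 β>0′) (pos*pos⇒pos α>0 β>0)

  launch : ∀ {e₁ f₁ A B} → Transition xv yv e₁ f₁ A B → Launch e₁ f₁ A B
  launch (direct {u} st u+w≡y) = record
    { σ = true ; A≡ = refl ; B≡ = refl ; run = done u+w≡y ; inv = Invariant-P st
    ; x-adj-e = ∣∣≡1⇒IsUnit (proj₁ st) ; x-adj-f = subst IsUnit (sym (det-x-u⊖x xv u)) (∣∣≡1⇒IsUnit (proj₁ st))
    ; det≢0 = βnum-pos⇒det≢0 u (proj₂ (proj₁ (proj₂ st))) }
  launch (viaP {u} st _ _ L) = record
    { σ = true ; A≡ = refl ; B≡ = refl
    ; run = Loop⇒Run true L (adjacent-ef (Invariant-P st)) (proj₂ (proj₁ (proj₂ st))) (proj₂ (proj₂ (proj₂ st)))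
    ; inv = Invariant-P st
    ; x-adj-e = ∣∣≡1⇒IsUnit (proj₁ st) ; x-adj-f = subst IsUnit (sym (det-x-u⊖x xv u)) (∣∣≡1⇒IsUnit (proj₁ st))
    ; det≢0 = βnum-pos⇒det≢0 u (proj₂ (proj₁ (proj₂ st))) }
  launch (viaN {u} st _ _ L) = record
    { σ = false ; A≡ = refl ; B≡ = refl
    ; run = Loop⇒Run false L (adjacent-ef (Invariant-N st)) (proj₂ (proj₂ (proj₂ st))) (proj₂ (proj₁ (proj₂ st)))
    ; inv = Invariant-N st
    ; x-adj-e = subst IsUnit (sym (det-x-u⊖x xv u)) (∣∣≡1⇒IsUnit (proj₁ st)) ; x-adj-f = ∣∣≡1⇒IsUnit (proj₁ st)
    ; det≢0 = βnum-pos⇒det≢0 u (proj₂ (proj₁ (proj₂ st))) }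

module Classes (x y : Pt) where
  open Launching x y public

  cone-of : ∀ σ u v → HasSign σ (κ xv yv u) → HasSign σ (κ xv yv v) → ConeRel xv yv u v
  cone-of true  _ _ p q = inj₁ (p , q)
  cone-of false _ _ p q = inj₂ (p , q)

  cone-sign : ∀ σ u v → HasSign σ (κ xv yv u) → ConeRel xv yv u v → HasSign σ (κ xv yv v)
  cone-sign true  _ _ _ (inj₁ (_ , q)) = q
  cone-sign true  _ _ p (inj₂ (n , _)) = ⊥-elim (ZP.<-asym p n)
  cone-sign false _ _ p (inj₁ (q , _)) = ⊥-elim (ZP.<-asym q p)
  cone-sign false _ _ _ (inj₂ (_ , q)) = q

  ConeRel-sym : ∀ u v → ConeRel xv yv u v → ConeRel xv yv v u
  ConeRel-sym _ _ = Sum.map Product.swap Product.swap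

  κ≢0 : ∀ c → ¬ (c ≈ x) → ¬ (c ≈ y) → det xv yv ≢ 0ℤ → κ xv yv (vec c) ≢ 0ℤ
  κ≢0 c c≉x c≉y D≢0 =
    [ [ c≉y ∘ c≋y , D≢0 ]′ ∘ ZP.i*j≡0⇒i≡0∨j≡0 (det (vec c) yv)
    , [ c≉x ∘ c≋x , D≢0 ]′ ∘ ZP.i*j≡0⇒i≡0∨j≡0 (det xv (vec c)) ]′
    ∘ ZP.i*j≡0⇒i≡0∨j≡0 (αnum xv yv (vec c))
    where
      primitiveOf : ∀ p → Primitive (vec p)
      primitiveOf p = Unimodular⇒Primitive (vec p) (unimod p)
      c≋y : det (vec c) yv ≡ 0ℤ → c ≈ y
      c≋y = det≡0⇒≋ (vec c) yv (primitiveOf c) (primitiveOf y)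
      c≋x : det xv (vec c) ≡ 0ℤ → c ≈ x
      c≋x = ≋-sym ∘ det≡0⇒≋ xv (vec c) (primitiveOf x) (primitiveOf c)

  side-of : ∀ σ c → ¬ (c ≈ x) → ¬ (c ≈ y) → det xv yv ≢ 0ℤ →
            HasSign σ (κ xv yv (vec c)) ⊎ HasSign (not σ) (κ xv yv (vec c))
  side-of σ c c≉x c≉y D≢0 = HasSign-or-not σ (HasSign-trichotomy (κ xv yv (vec c)) (κ≢0 c c≉x c≉y D≢0))

  InSide : Bool → ∀ {n} → Path x y n → Set
  InSide σ {n} P = ∀ i → Interior P i → HasSign σ (κ xv yv (vec (vtx P i)))

  InSide⇒Consistent : ∀ σ {n} (P : Path x y n) → InSide σ P → Consistent P
  InSide⇒Consistent σ P P-side i j i-int j-int = cone-of σ (vec (vtx P i)) (vec (vtx P j)) (P-side i i-int) (P-side j j-int)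

  UniqueShortestInSide : Bool → ℕ → Set
  UniqueShortestInSide σ n = Σ (Path x y n) λ P → InSide σ P ×
    ((m : ℕ) (Q : Path x y m) → InSide σ Q → n ≤ m × (m ≡ n → PathEq P Q))

  ePath-uniqueShortest : ∀ {σ e f a b} (L : Run σ e f a b) (I : Invariant σ e f) → AdjV xv e →
                         UniqueShortestInSide σ (suc (suc a))
  ePath-uniqueShortest {σ} {a = a} L I x-adj-e = toPath ePath , P-side , minimal
    where
      open EPath L I x-adj-e
      P-side : InSide σ (toPath ePath)
      P-side i (≉x , ≉y) = vertex-sign (toℕ i) (FP.toℕ≤pred[n] i) ≉x ≉y
      minimal : (m : ℕ) (Q : Path x y m) → InSide σ Q → suc (suc a) ≤ m × (m ≡ suc (suc a) → PathEq (toPath ePath) Q)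
      minimal m Q Q-side = Minimal.ePath-shortest Q′ Q′-sign , λ m≡ → sym m≡ , λ i j i≡j →
          subst (λ p → vec (vertex (toℕ i)) ≋ vec p) (fromPath-vtx Q j)
            (subst (λ s → vec (vertex (toℕ i)) ≋ vec (g Q′ s)) i≡j
              (Minimal.ePath-unique Q′ Q′-sign m≡ (toℕ i) (subst (toℕ i ≤_) (sym m≡) (FP.toℕ≤pred[n] i))))
        where
          Q′ = fromPath Q
          Q′-sign : ∀ k → k ≤ m → ¬ (g Q′ k ≈ x) → ¬ (g Q′ k ≈ y) → HasSign σ (κ xv yv (vec (g Q′ k)))
          Q′-sign k _ ≉x ≉y = Q-side (clamp m k) (≉x , ≉y)

  second-vertex-interior : ∀ {m} (Q : Path x y (suc (suc m))) → Interior Q (fsuc fzero)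
  second-vertex-interior {m} Q =
    (λ h → 1≢0 (distinct Q (fsuc fzero) fzero (≋-trans h (≋-sym (start Q))))) ,
    (λ h → 1≢last (distinct Q (fsuc fzero) (fromℕ (suc (suc m))) (≋-trans h (≋-sym (end Q)))))
    where
      1≢0 : fsuc {suc (suc m)} fzero ≢ fzero
      1≢0 ()
      1≢last : fsuc fzero ≢ fsuc (fsuc (fromℕ m))
      1≢last ()

  module WithLaunch (x≉y : ¬ (x ≈ y)) (x≁y : ¬ Adj x y) {e₁ f₁ A B} (S : Launch e₁ f₁ A B) where
    open Launch S

    eSide : UniqueShortestInSide σ (suc (suc a))
    eSide = ePath-uniqueShortest run inv x-adj-e

    fSide : UniqueShortestInSide (not σ) (suc (suc b))
    fSide = ePath-uniqueShortest (Run-swap run) (Invariant-swap inv) x-adj-f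

    -- A consistent path has an interior vertex (x, y are distinct and not adjacent), whose class it keeps.
    Consistent⇒InSide : ∀ {m} (Q : Path x y m) → Consistent Q → InSide σ Q ⊎ InSide (not σ) Q
    Consistent⇒InSide {zero} Q _ = ⊥-elim (x≉y (≋-trans (≋-sym (start Q)) (end Q)))
    Consistent⇒InSide {suc zero} Q _ =
      ⊥-elim (x≁y (AdjV-respʳ-≋ {xv} {v₁} (end Q) (AdjV-respˡ-≋ {vec (vtx Q fzero)} {xv} {v₁} (start Q) (adjacent Q fzero))))
      where v₁ = vec (vtx Q (fsuc fzero))
    Consistent⇒InSide {suc (suc m)} Q Q-cons =
      Sum.map (spread σ) (spread (not σ)) (side-of σ v (proj₁ v-int) (proj₂ v-int) det≢0)
      where
        v = vtx Q (fsuc fzero)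
        v-int = second-vertex-interior Q
        spread : ∀ τ → HasSign τ (κ xv yv (vec v)) → InSide τ Q
        spread τ s i i-int =
          cone-sign τ (vec v) (vec (vtx Q i)) s (ConeRel-sym (vec (vtx Q i)) (vec v) (Q-cons i (fsuc fzero) i-int v-int))

    InSide-shortest-unique : ∀ τ {n} → UniqueShortestInSide τ n → ∀ {ni nj} (Pi : Path x y ni) (Pj : Path x y nj) →
      ShortestConsistent Pi → InSide τ Pi → ShortestConsistent Pj → InSide τ Pj → PathEq Pi Pj
    InSide-shortest-unique τ {n} (C , C-side , C-min) Pi Pj (_ , Pi-min) Pi-side (_ , Pj-min) Pj-side =
      PathEq-trans-sym {P = C} {Q = Pi} {R = Pj} (C≡ Pi Pi-min Pi-side) (C≡ Pj Pj-min Pj-side)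
      where
        C≡ : ∀ {k} (R : Path x y k) → ((m : ℕ) (Q : Path x y m) → Consistent Q → k ≤ m) → InSide τ R → PathEq C R
        C≡ R R-min R-side = proj₂ (C-min _ R R-side)
          (NP.≤-antisym (R-min n C (InSide⇒Consistent τ C C-side)) (proj₁ (C-min _ R R-side)))

    at-most-two : (n₁ n₂ n₃ : ℕ) (P₁ : Path x y n₁) (P₂ : Path x y n₂) (P₃ : Path x y n₃) →
      ShortestConsistent P₁ → ShortestConsistent P₂ → ShortestConsistent P₃ →
      PathEq P₁ P₂ ⊎ PathEq P₁ P₃ ⊎ PathEq P₂ P₃
    at-most-two _ _ _ P₁ P₂ P₃ s₁ s₂ s₃
      with Consistent⇒InSide P₁ (proj₁ s₁) | Consistent⇒InSide P₂ (proj₁ s₂) | Consistent⇒InSide P₃ (proj₁ s₃)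
    ... | inj₁ c₁ | inj₁ c₂ | _       = inj₁ (InSide-shortest-unique σ eSide P₁ P₂ s₁ c₁ s₂ c₂)
    ... | inj₂ c₁ | inj₂ c₂ | _       = inj₁ (InSide-shortest-unique (not σ) fSide P₁ P₂ s₁ c₁ s₂ c₂)
    ... | inj₁ c₁ | inj₂ _  | inj₁ c₃ = inj₂ (inj₁ (InSide-shortest-unique σ eSide P₁ P₃ s₁ c₁ s₃ c₃))
    ... | inj₁ _  | inj₂ c₂ | inj₂ c₃ = inj₂ (inj₂ (InSide-shortest-unique (not σ) fSide P₂ P₃ s₂ c₂ s₃ c₃))
    ... | inj₂ _  | inj₁ c₂ | inj₁ c₃ = inj₂ (inj₂ (InSide-shortest-unique σ eSide P₂ P₃ s₂ c₂ s₃ c₃))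
    ... | inj₂ c₁ | inj₁ _  | inj₂ c₃ = inj₂ (inj₁ (InSide-shortest-unique (not σ) fSide P₁ P₃ s₁ c₁ s₃ c₃))

    Consistent⇒long : ∀ {m} (Q : Path x y m) → Consistent Q →
                      (suc (suc a) ≤ m × InSide σ Q) ⊎ (suc (suc b) ≤ m × InSide (not σ) Q)
    Consistent⇒long Q Q-cons = Sum.map (λ c → proj₁ (proj₂ (proj₂ eSide) _ Q c) , c)
                                       (λ c → proj₁ (proj₂ (proj₂ fSide) _ Q c) , c) (Consistent⇒InSide Q Q-cons)

    unique-if-shorter : ∀ τ τ′ {n n′} → UniqueShortestInSide τ n → n < n′ →
      (∀ {m} (Q : Path x y m) → Consistent Q → (n ≤ m × InSide τ Q) ⊎ (n′ ≤ m × InSide τ′ Q)) →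
      UniqueShortestConsistent x y
    unique-if-shorter τ τ′ {n} (C , C-side , C-min) n<n′ long = n , C , (C-cons , shortest) , unique
      where
        C-cons = InSide⇒Consistent τ C C-side
        shortest : (m : ℕ) (Q : Path x y m) → Consistent Q → n ≤ m
        shortest m Q Q-cons = [ proj₁ , NP.≤-trans (NP.<⇒≤ n<n′) ∘ proj₁ ]′ (long Q Q-cons)
        unique : (m : ℕ) (Q : Path x y m) → ShortestConsistent Q → PathEq C Q
        unique m Q (Q-cons , Q-min) with long Q Q-cons
        ... | inj₁ (n≤m , Q-side) = proj₂ (C-min m Q Q-side) (NP.≤-antisym (Q-min n C C-cons) n≤m)
        ... | inj₂ (n′≤m , _) = ⊥-elim (NP.<⇒≱ n<n′ (NP.≤-trans n′≤m (Q-min n C C-cons)))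

    -- If d_a = d_b, the e-path and the f-path are both shortest consistent, but their second
    -- vertices lie in different classes.
    unique⇔ : UniqueShortestConsistent x y ⇔ (suc A ≢ suc B)
    unique⇔ = mk⇔ unique⇒≢ ≢⇒unique
      where
        unique⇒≢ : UniqueShortestConsistent x y → suc A ≢ suc B
        unique⇒≢ (_ , P , _ , P-unique) A≡B =
          HasSign-exclusive σ e-sign₂ (subst (HasSign (not σ)) (sym (κ-resp-≋ xv yv same₂)) f-sign₂)
          where
            Pe = proj₁ eSide
            Pf = proj₁ fSide
            a≡b : suc (suc a) ≡ suc (suc b)
            a≡b = trans (cong suc (sym A≡)) (trans A≡B (cong suc B≡))
            Pe-sc : ShortestConsistent Pe
            Pe-sc = InSide⇒Consistent σ Pe (proj₁ (proj₂ eSide)) ,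
                    λ m Q Q-cons → [ proj₁ , subst (_≤ m) (sym a≡b) ∘ proj₁ ]′ (Consistent⇒long Q Q-cons)
            Pf-sc : ShortestConsistent Pf
            Pf-sc = InSide⇒Consistent (not σ) Pf (proj₁ (proj₂ fSide)) ,
                    λ m Q Q-cons → [ subst (_≤ m) a≡b ∘ proj₁ , proj₁ ]′ (Consistent⇒long Q Q-cons)
            same₂ : vec (vtx Pe (fsuc fzero)) ≋ vec (vtx Pf (fsuc fzero))
            same₂ = proj₂ (PathEq-trans-sym {P = P} {Q = Pe} {R = Pf} (P-unique _ Pe Pe-sc) (P-unique _ Pf Pf-sc))
                      (fsuc fzero) (fsuc fzero) refl
            e-sign₂ = proj₁ (proj₂ eSide) (fsuc fzero) (second-vertex-interior Pe)
            f-sign₂ = proj₁ (proj₂ fSide) (fsuc fzero) (second-vertex-interior Pf)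
        ≢⇒unique : suc A ≢ suc B → UniqueShortestConsistent x y
        ≢⇒unique A≢B with NP.<-cmp (suc (suc a)) (suc (suc b))
        ... | tri< lt _ _ = unique-if-shorter σ (not σ) eSide lt Consistent⇒long
        ... | tri≈ _ eq _ = ⊥-elim (A≢B (trans (cong suc A≡) (trans eq (cong suc (sym B≡)))))
        ... | tri> _ _ gt = unique-if-shorter (not σ) σ fSide gt λ Q Q-cons → Sum.swap (Consistent⇒long Q Q-cons)

    ShortestInClass : Pt → ℕ → Set
    ShortestInClass c n = Σ (Path x y n) λ P → InClassOf c P ×
      ((m : ℕ) (Q : Path x y m) → InClassOf c Q → n ≤ m × (m ≡ n → PathEq P Q))

    InSide⇒ShortestInClass : ∀ τ {n} c → HasSign τ (κ xv yv (vec c)) → UniqueShortestInSide τ n → ShortestInClass c n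
    InSide⇒ShortestInClass τ c c-sign (P , P-side , P-min) =
      P , (λ i i-int → cone-of τ (vec (vtx P i)) (vec c) (P-side i i-int) c-sign) ,
      λ m Q Q-class → P-min m Q λ i i-int →
        cone-sign τ (vec c) (vec (vtx Q i)) c-sign (ConeRel-sym (vec (vtx Q i)) (vec c) (Q-class i i-int))

    shortest-in-class : (c : Pt) → ¬ (c ≈ x) → ¬ (c ≈ y) →
      Σ ℕ λ n → Σ (Path x y n) λ P → InClassOf c P ×
        ((m : ℕ) (Q : Path x y m) → InClassOf c Q → n ≤ m × (m ≡ n → PathEq P Q)) ×
        (ConeRel xv yv (vec c) e₁ → n ≡ suc A) × (ConeRel xv yv (vec c) f₁ → n ≡ suc B)
    shortest-in-class c c≉x c≉y = [ e-class , f-class ]′ (side-of σ c c≉x c≉y det≢0)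
      where
        Lengths : ℕ → Set
        Lengths n = (ConeRel xv yv (vec c) e₁ → n ≡ suc A) × (ConeRel xv yv (vec c) f₁ → n ≡ suc B)
        package : ∀ {n} → ShortestInClass c n → Lengths n →
          Σ ℕ λ n → Σ (Path x y n) λ P → InClassOf c P ×
            ((m : ℕ) (Q : Path x y m) → InClassOf c Q → n ≤ m × (m ≡ n → PathEq P Q)) × Lengths n
        package (P , P-class , P-min) lengths = _ , P , P-class , P-min , lengths
        e-class = λ s → package (InSide⇒ShortestInClass σ c s eSide)
          ((λ _ → cong suc (sym A≡)) ,
           λ c~f → ⊥-elim (HasSign-exclusive σ (cone-sign σ (vec c) f₁ s c~f) (f-sign inv)))
        f-class = λ s → package (InSide⇒ShortestInClass (not σ) c s fSide)
          ((λ c~e → ⊥-elim (HasSign-exclusive σ (e-sign inv) (cone-sign (not σ) (vec c) e₁ s c~e))) ,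
           λ _ → cong suc (sym B≡))

record Walk (p q : Pt) (n : ℕ) : Set where
  field
    wg    : ℕ → Pt
    wg0   : wg 0 ≈ p
    wgn   : wg n ≈ q
    wgadj : ∀ k → suc k ≤ n → Adj (wg k) (wg (suc k))
open Walk public

Walk-respˡ : ∀ {p p′ q n} → Walk p q n → p ≈ p′ → Walk p′ q n
Walk-respˡ W h = record { wg = wg W ; wg0 = ≋-trans (wg0 W) h ; wgn = wgn W ; wgadj = wgadj W }

Walk-edge : ∀ {u v} → AdjV (vec u) (vec v) → Walk u v 1
Walk-edge {u} {v} h = record { wg = λ { zero → u ; (suc _) → v } ; wg0 = ≋-refl ; wgn = ≋-refl
                             ; wgadj = λ { zero _ → h ; (suc k) (s≤s ()) } }

Walk-cons : ∀ {v q n} (p : Pt) (W : Walk v q n) → AdjV (vec p) (vec (wg W 0)) → Walk p q (suc n)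
Walk-cons p W h = record { wg = λ { zero → p ; (suc k) → wg W k } ; wg0 = ≋-refl ; wgn = wgn W
                         ; wgadj = λ { zero _ → h ; (suc k) (s≤s k<) → wgadj W k k< } }

Walk-tail : ∀ {p q n} (W : Walk p q (suc n)) → Walk (wg W 1) q n
Walk-tail W = record { wg = wg W ∘ suc ; wg0 = ≋-refl ; wgn = wgn W ; wgadj = λ k k< → wgadj W (suc k) (s≤s k<) }

Walk-++ : ∀ {p r q} n₁ {n₂} → Walk p r n₁ → Walk r q n₂ → Walk p q (n₁ ℕ.+ n₂)
Walk-++ zero W₁ W₂ = Walk-respˡ W₂ (≋-trans (≋-sym (wgn W₁)) (wg0 W₁))
Walk-++ (suc n) W₁ W₂ = Walk-respˡ (Walk-cons (wg W₁ 0) W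
  (AdjV-respʳ-≋ {vec (wg W₁ 0)} {vec (wg W₁ 1)} {vec (wg W 0)} (≋-sym (wg0 W)) (wgadj W₁ 0 (s≤s z≤n)))) (wg0 W₁)
  where W = Walk-++ n (Walk-tail W₁) W₂

find-index : (g : ℕ → Pt) (v : Pt) (j : ℕ) → (Σ ℕ λ i → i < j × g i ≈ v) ⊎ (∀ i → i < j → ¬ (g i ≈ v))
find-index g v zero = inj₂ (λ i ())
find-index g v (suc j) with vec (g j) ≋? vec v
... | yes h = inj₁ (j , NP.≤-refl , h)
... | no ¬h with find-index g v j
...   | inj₁ (i , i<j , h) = inj₁ (i , NP.≤-trans i<j (NP.n≤1+n j) , h)
...   | inj₂ none = inj₂ λ i i<1+j h →
        [ (λ i<j → none i i<j h) , (λ { refl → ¬h h }) ]′ (NP.m≤n⇒m<n∨m≡n (NP.≤-pred i<1+j))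

NPath-drop : ∀ {p q m} (P : NPath p q m) (i : ℕ) → i ≤ m → NPath (g P i) q (m ∸ i)
NPath-drop {p} {q} {m} P i i≤m = record
  { g = λ k → g P (i ℕ.+ k)
  ; g0 = subst (λ t → g P t ≈ g P i) (sym (NP.+-identityʳ i)) ≋-refl
  ; gn = subst (λ t → g P t ≈ q) (sym (NP.m+[n∸m]≡n i≤m)) (gn P)
  ; gadj = λ k k< → subst (λ t → Adj (g P (i ℕ.+ k)) (g P t)) (sym (NP.+-suc i k))
                      (gadj P (i ℕ.+ k) (subst (_≤ m) (NP.+-suc i k) (bound (suc k) k<)))
  ; gdist = λ a b a≤ b≤ h → NP.+-cancelˡ-≡ i a b (gdist P (i ℕ.+ a) (i ℕ.+ b) (bound a a≤) (bound b b≤) h)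
  }
  where
    bound : ∀ k → k ≤ m ∸ i → i ℕ.+ k ≤ m
    bound k k≤ = subst (i ℕ.+ k ≤_) (NP.m+[n∸m]≡n i≤m) (NP.+-monoʳ-≤ i k≤)

NPath-cons : ∀ {v q m} (p : Pt) (P : NPath v q m) → AdjV (vec p) (vec (g P 0)) →
             (∀ k → k < suc m → ¬ (g P k ≈ p)) → NPath p q (suc m)
NPath-cons {m = m} p P h p∉P = record
  { g = vertex ; g0 = ≋-refl ; gn = gn P
  ; gadj = λ { zero _ → h ; (suc k) (s≤s k<) → gadj P k k< }
  ; gdist = distinct′ }
  where
    vertex : ℕ → Pt
    vertex zero = p
    vertex (suc k) = g P k
    distinct′ : ∀ i j → i ≤ suc m → j ≤ suc m → vertex i ≈ vertex j → i ≡ j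
    distinct′ zero zero _ _ _ = refl
    distinct′ zero (suc j) _ (s≤s j≤) h = ⊥-elim (p∉P j (s≤s j≤) (≋-sym h))
    distinct′ (suc i) zero (s≤s i≤) _ h = ⊥-elim (p∉P i (s≤s i≤) h)
    distinct′ (suc i) (suc j) (s≤s i≤) (s≤s j≤) h = cong suc (gdist P i j i≤ j≤ h)

NPath-respˡ : ∀ {p p′ q n} → NPath p q n → p ≈ p′ → NPath p′ q n
NPath-respˡ P h = record { g = g P ; g0 = ≋-trans (g0 P) h ; gn = gn P ; gadj = gadj P ; gdist = gdist P }

-- Prepend the first vertex to a path made from the tail, cutting the loop if it already occurs.
Walk⇒NPath : ∀ {p q} n → Walk p q n → Σ ℕ λ m → NPath p q m
Walk⇒NPath zero W = 0 , record { g = wg W ; g0 = wg0 W ; gn = wgn W ; gadj = λ k ()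
  ; gdist = λ { zero zero _ _ _ → refl ; (suc _) _ () _ _ ; zero (suc _) _ () _ } }
Walk⇒NPath (suc n) W with Walk⇒NPath n (Walk-tail W)
... | m , P with find-index (g P) (wg W 0) (suc m)
...   | inj₁ (i , i≤m , h) = m ∸ i , NPath-respˡ (NPath-drop P i (NP.≤-pred i≤m)) (≋-trans h (wg0 W))
...   | inj₂ none = suc m , NPath-respˡ (NPath-cons (wg W 0) P
          (AdjV-respʳ-≋ {vec (wg W 0)} {vec (wg W 1)} {vec (g P 0)} (≋-sym (g0 P)) (wgadj W 0 (s≤s z≤n))) none) (wg0 W)

base : Pt
base = pt (+ 1 , + 0) refl

WalksTo : Pt → Set
WalksTo p = (Σ ℕ λ n → Walk p base n) × (Σ ℕ λ n → Walk base p n)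

WalksTo-base : ∀ p → p ≈ base → WalksTo p
WalksTo-base p h = (0 , record { wg = λ _ → p ; wg0 = ≋-refl ; wgn = h ; wgadj = λ k () })
                 , (0 , record { wg = λ _ → p ; wg0 = h ; wgn = ≋-refl ; wgadj = λ k () })

WalksTo-adj : ∀ p v → AdjV (vec p) (vec v) → WalksTo v → WalksTo p
WalksTo-adj p v h ((n , W) , (n′ , W′)) =
  (suc n , Walk-cons p W (AdjV-respʳ-≋ {vec p} {vec v} {vec (wg W 0)} (≋-sym (wg0 W)) h)) ,
  (n′ ℕ.+ 1 , Walk-++ n′ W′ (Walk-edge {v} {p} (AdjV-sym {vec p} {vec v} h)))

second≡0⇒≈base : ∀ a (u : Unimodular (a , + 0)) → pt (a , + 0) u ≈ base
second≡0⇒≈base a u with ∣∣≡1⇒IsUnit {a} (trans (sym (G.gcd-identityʳ ∣ a ∣)) u)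
... | inj₁ refl = inj₁ refl
... | inj₂ refl = inj₂ refl

-- With s a + t b = 1 and s = r + q b, the vector (- t - q a , r) is adjacent to (a , b), and 0 ≤ r < ∣b∣.
euclid-step : ∀ a b s t q r → s ≡ r + q * b → s * a + t * b ≡ + 1 → det (a , b) (- t - q * a , r) ≡ + 1
euclid-step a b s t q r s≡ e = trans (lem a b r t q) (trans (cong (λ s → s * a + t * b) (sym s≡)) e)
  where lem : ∀ a b r t q → a * r - b * (- t - q * a) ≡ (r + q * b) * a + t * b
        lem = solve-∀

walksTo-step : ∀ n a b .{{_ : Z.NonZero b}} (u : Unimodular (a , b)) → ∣ b ∣ ≤ suc n →
               (∀ (p : Pt) → ∣ proj₂ (vec p) ∣ ≤ n → WalksTo p) → WalksTo (pt (a , b) u)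
walksTo-step n a b u ∣b∣≤ walks with Unimodular⇒Primitive (a , b) u
... | s , t , e = WalksTo-adj (pt (a , b) u) v (inj₁ adj) (walks v (NP.≤-pred (NP.≤-trans (ZD.n%d<d s b) ∣b∣≤)))
  where
    v′ : V2
    v′ = (- t - (s Z./ b) * a , + (s Z.% b))
    adj : det (a , b) v′ ≡ + 1
    adj = euclid-step a b s t (s Z./ b) (+ (s Z.% b)) (ZD.a≡a%n+[a/n]*n s b) e
    v : Pt
    v = pt v′ (Primitive⇒Unimodular v′ (IsUnit-det⇒Primitiveʳ (a , b) v′ (inj₁ adj)))

walksTo : ∀ n (p : Pt) → ∣ proj₂ (vec p) ∣ ≤ n → WalksTo p
walksTo n (pt (a , + zero) u) _ = WalksTo-base _ (second≡0⇒≈base a u)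
walksTo zero (pt (a , +[1+ _ ]) u) ()
walksTo zero (pt (a , -[1+ _ ]) u) ()
walksTo (suc n) (pt (a , b@(+[1+ _ ])) u) ∣b∣≤ = walksTo-step n a b u ∣b∣≤ (walksTo n)
walksTo (suc n) (pt (a , b@(-[1+ _ ])) u) ∣b∣≤ = walksTo-step n a b u ∣b∣≤ (walksTo n)

connected : Connected
connected p q with walksTo _ p NP.≤-refl | walksTo _ q NP.≤-refl
... | (n₁ , W₁) , _ | _ , (n₂ , W₂) with Walk⇒NPath _ (Walk-++ n₁ W₁ W₂)
...   | m , P = m , toPath P

theorem1 : (x y : Pt) → ¬ (x ≈ y) → ¬ Adj x y →
    ∀ {e₁ f₁ : V2} {Aᵣ Bₗ : ℕ} → Transition (vec x) (vec y) e₁ f₁ Aᵣ Bₗ →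
    -- 1. for each class (given by a point c ∉ {x̄, ȳ}) a unique shortest path
    --    with interior in that class, of length 1+Aᵣ resp. 1+Bₗ
    ((c : Pt) → ¬ (c ≈ x) → ¬ (c ≈ y) →
      Σ ℕ λ n → Σ (Path x y n) λ P → InClassOf c P ×
        ((m : ℕ) (Q : Path x y m) → InClassOf c Q → n ≤ m × (m ≡ n → PathEq P Q)) ×
        (ConeRel (vec x) (vec y) (vec c) e₁ → n ≡ suc Aᵣ) ×
        (ConeRel (vec x) (vec y) (vec c) f₁ → n ≡ suc Bₗ))
    -- 1'. G is connected
    × Connected
    -- 2. at most two shortest consistent paths
    × ((n₁ n₂ n₃ : ℕ) (P₁ : Path x y n₁) (P₂ : Path x y n₂) (P₃ : Path x y n₃) →
        ShortestConsistent P₁ → ShortestConsistent P₂ → ShortestConsistent P₃ →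
        PathEq P₁ P₂ ⊎ PathEq P₁ P₃ ⊎ PathEq P₂ P₃)
    -- 3. uniqueness iff d_a ≠ d_b
    × (UniqueShortestConsistent x y ⇔ (suc Aᵣ ≢ suc Bₗ))
theorem1 x y x≉y x≁y T = shortest-in-class , connected , at-most-two , unique⇔
  where open Classes.WithLaunch x y x≉y x≁y (Classes.launch x y T)
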